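{- $\mathrm{VCdim}\equiv_{\mathrm{sW}}\mathrm{VCdim}^+\equiv_{\mathrm{sW}}\mathsf{SORT}$.
   Context: Weihrauch reducibility: a represented space is a set $X$ with a surjective partial map $\delta_X:\subseteq\mathbb{N}^\mathbb{N}\to X$. A problem is a partial multivalued map $f:\subseteq X\rightrightarrows Y$ between represented spaces; $F:\subseteq\mathbb{N}^\mathbb{N}\to\mathbb{N}^\mathbb{N}$ realizes $f$ if $\delta_Y F(p)\in f(\delta_X(p))$ for all $p\in\mathrm{dom}(f\circ\delta_X)$. We write $f\le_{\mathrm{sW}}g$ if there are computable $H,K:\subseteq\mathbb{N}^\mathbb{N}\to\mathbb{N}^\mathbb{N}$ such that $HGK$ realizes $f$ whenever $G$ realizes $g$; $\equiv_{\mathrm{sW}}$ is the induced equivalence. Closed sets: fix a computable bijective enumeration $n\mapsto w_n$ of $\{0,1\}^*$ and let $B_n=w_n2^\mathbb{N}$. $\mathcal{A}_+$ is the set of closed subsets of Cantor space $2^\mathbb{N}$ where $p$ names $A$ iff $\{n:n+1\in\mathrm{range}(p)\}=\{n:B_n\cap A\neq\emptyset\}$; $\mathcal{A}_-$ is the same set where $p$ names $2^\mathbb{N}\setminus\bigcup_{n+1\in\mathrm{range}(p)}B_n$; $\mathcal{A}$ is the same set where $\langle p,q\rangle$ names $A$ iff $p$ names $A$ in $\mathcal{A}_+$ and $q$ names $A$ in $\mathcal{A}_-$ ($\langle\cdot,\cdot\rangle$ a standard pairing on Baire space). VC dimension: elements of $2^\mathbb{N}$ are identified with subsets of $\mathbb{N}$.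 For $\mathcal{C}\subseteq 2^\mathbb{N}$ and finite $A\subseteq\mathbb{N}$, $A$ is shattered by $\mathcal{C}$ if $|\{B\cap A:B\in\mathcal{C}\}|=2^{|A|}$; $\mathrm{VCdim}(\mathcal{C})=\sup\{|A|:A$ finite and shattered by $\mathcal{C}\}\in\mathbb{N}\cup\{\infty\}$ for nonempty $\mathcal{C}$, and $\mathrm{VCdim}(\emptyset)=0$. $\mathbb{N}_\infty=\mathbb{N}\cup\{\infty\}$ is represented by $0^n1p\mapsto n$ ($p\in\mathbb{N}^\mathbb{N}$) and $\widehat{0}\mapsto\infty$ ($\widehat{0}$ the constant zero sequence). $\mathrm{VCdim}:\mathcal{A}\to\mathbb{N}_\infty$ and $\mathrm{VCdim}^+:\mathcal{A}_+\to\mathbb{N}_\infty$ are the map $\mathcal{C}\mapsto\mathrm{VCdim}(\mathcal{C})$ on the respective input spaces. $\mathsf{SORT}:2^\mathbb{N}\to2^\mathbb{N}$ maps $p$ to $\widehat{0}$ if $p$ contains infinitely many zeros and to $0^n\widehat{1}$ if $p$ contains exactly $n$ zeros. -}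

module Defs where

open import Level using (Level; _⊔_) renaming (suc to lsuc)
open import Data.Nat using (ℕ; zero; suc; _+_; _*_; _≤_; _<_; _/_; _%_; _≡ᵇ_; _<ᵇ_)
open import Data.Bool using (Bool; true; false; if_then_else_)
open import Data.Fin using (Fin)
open import Data.Vec using (Vec; []; _∷_; lookup)
open import Data.List using (List; []; _∷_; length)
open import Data.List.Membership.Propositional using (_∈_)
open import Data.List.Relation.Unary.Unique.Propositional using (Unique)
open import Data.Product using (Σ; _×_; _,_)
open import Data.Sum using (_⊎_)
open import Data.Unit using (⊤)
open import Relation.Nullary using (¬_)
open import Relation.Binary.PropositionalEquality using (_≡_)

Baire : Set
Baire = ℕ → ℕ

Cantor : Set
Cantor = ℕ → Bool   -- false = 0, true = 1; x ⊆ ℕ via  n ∈ x  iff  x n ≡ true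

bit : Bool → ℕ
bit false = 0
bit true  = 1

-- Type-2 computability: partial recursive functions relative to an
-- oracle α : ℕ → ℕ (Kleene's oracle μ-recursive functions).

data PR : ℕ → Set where
  pzero   : ∀ {n} → PR n
  psucc   : PR 1
  pproj   : ∀ {n} → Fin n → PR n
  poracle : PR 1
  pcomp   : ∀ {m n} → PR m → Vec (PR n) m → PR n
  pprec   : ∀ {n} → PR n → PR (suc (suc n)) → PR (suc n)
  pmin    : ∀ {n} → PR (suc n) → PR n

data Eval : ∀ {n} → PR n → Baire → Vec ℕ n → ℕ → Set
data EvalAll : ∀ {n m} → Vec (PR n) m → Baire → Vec ℕ n → Vec ℕ m → Set

data Eval where
  ev-zero   : ∀ {n α} {xs : Vec ℕ n} → Eval pzero α xs 0
  ev-succ   : ∀ {α x} → Eval psucc α (x ∷ []) (suc x)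
  ev-proj   : ∀ {n α} {xs : Vec ℕ n} (i : Fin n) → Eval (pproj i) α xs (lookup xs i)
  ev-oracle : ∀ {α x} → Eval poracle α (x ∷ []) (α x)
  ev-comp   : ∀ {m n α} {f : PR m} {gs : Vec (PR n) m} {xs ys y} →
              EvalAll gs α xs ys → Eval f α ys y → Eval (pcomp f gs) α xs y
  ev-prec0  : ∀ {n α} {g : PR n} {h : PR (suc (suc n))} {xs y} →
              Eval g α xs y → Eval (pprec g h) α (0 ∷ xs) y
  ev-precS  : ∀ {n α} {g : PR n} {h : PR (suc (suc n))} {xs k y z} →
              Eval (pprec g h) α (k ∷ xs) y → Eval h α (k ∷ y ∷ xs) z →
              Eval (pprec g h) α (suc k ∷ xs) z
  ev-min    : ∀ {n α} {f : PR (suc n)} {xs k} →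
              Eval f α (k ∷ xs) 0 →
              (∀ j → j < k → Σ ℕ λ v → Eval f α (j ∷ xs) (suc v)) →
              Eval (pmin f) α xs k

data EvalAll where
  ev-[] : ∀ {n α} {xs : Vec ℕ n} → EvalAll [] α xs []
  ev-∷  : ∀ {n m α} {g : PR n} {gs : Vec (PR n) m} {xs y ys} →
          Eval g α xs y → EvalAll gs α xs ys → EvalAll (g ∷ gs) α xs (y ∷ ys)

Computes : PR 1 → Baire → Baire → Set
Computes e p q = ∀ n → Eval e p (n ∷ []) (q n)

record RepSpace (ℓ : Level) : Set (lsuc ℓ) where
  field
    Carrier : Set ℓ
    δ       : Baire → Carrier → Set
open RepSpace public

Problem : ∀ {a b} → RepSpace a → RepSpace b → Set (lsuc Level.zero ⊔ a ⊔ b)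
Problem X Y = Carrier X → Carrier Y → Set   -- f x y : "y ∈ f(x)"

record PartialFun : Set₁ where
  field
    graph      : Baire → Baire → Set
    functional : ∀ {p q q'} → graph p q → graph p q' → ∀ n → q n ≡ q' n
open PartialFun public

Realizes : ∀ {a b} (X : RepSpace a) (Y : RepSpace b) → Problem X Y → PartialFun → Set (a ⊔ b)
Realizes X Y f F =
  ∀ p (x : Carrier X) → δ X p x →
    Σ Baire λ q → graph F p q × Σ (Carrier Y) λ y → δ Y q y × f x y

record Prob (a b : Level) : Set (lsuc (lsuc Level.zero ⊔ a ⊔ b)) where
  constructor prob
  field
    In  : RepSpace a
    Out : RepSpace b
    rel : Problem In Out
open Prob public

_≤sW_ : ∀ {a b c d} → Prob a b → Prob c d → Set (lsuc Level.zero ⊔ a ⊔ b ⊔ c ⊔ d)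
f ≤sW g =
  Σ (PR 1) λ eH → Σ (PR 1) λ eK →
    ∀ (G : PartialFun) → Realizes (In g) (Out g) (rel g) G →
    ∀ p (x : Carrier (In f)) → δ (In f) p x →
      Σ Baire λ k → Computes eK p k ×
      Σ Baire λ q → graph G k q ×
      Σ Baire λ h → Computes eH q h ×
      Σ (Carrier (Out f)) λ y → δ (Out f) h y × rel f x y

_≡sW_ : ∀ {a b c d} → Prob a b → Prob c d → Set (lsuc Level.zero ⊔ a ⊔ b ⊔ c ⊔ d)
f ≡sW g = (f ≤sW g) × (g ≤sW f)

-- bijective base-2: code [] = 0, code (b ∷ w) = 1 + bit b + 2 * code w
decodeWord : ℕ → ℕ → List Bool       -- first argument is fuel
decodeWord zero    _       = []
decodeWord (suc f) zero    = []
decodeWord (suc f) (suc m) = (m % 2 ≡ᵇ 1) ∷ decodeWord f (m / 2)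

word : ℕ → List Bool                 -- n ↦ w_n, a computable bijection ℕ → {0,1}*
word n = decodeWord n n

Prefix : List Bool → Cantor → Set
Prefix []      x = ⊤
Prefix (b ∷ w) x = (x 0 ≡ b) × Prefix w (λ i → x (suc i))

InB : ℕ → Cantor → Set
InB n x = Prefix (word n) x

Pred : Set₁
Pred = Cantor → Set

InRange : Baire → ℕ → Set
InRange p n = Σ ℕ λ k → p k ≡ suc n

Closed : Pred → Set
Closed A = Σ (ℕ → Bool) λ U → ∀ x →
  (A x → ¬ (Σ ℕ λ n → U n ≡ true × InB n x)) × (¬ (Σ ℕ λ n → U n ≡ true × InB n x) → A x)

δ₊ : Baire → Pred → Set
δ₊ p A = Closed A × (∀ n →
  (InRange p n → Σ Cantor λ x → InB n x × A x) × ((Σ Cantor λ x → InB n x × A x) → InRange p n))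

InUnion : Baire → Cantor → Set
InUnion p x = Σ ℕ λ n → InRange p n × InB n x

δ₋ : Baire → Pred → Set
δ₋ p A = ∀ x → (A x → ¬ InUnion p x) × (¬ InUnion p x → A x)

evens odds : Baire → Baire             -- ⟨p,q⟩(2n) = p n, ⟨p,q⟩(2n+1) = q n
evens r n = r (2 * n)
odds  r n = r (suc (2 * n))

δ𝒜 : Baire → Pred → Set
δ𝒜 r A = δ₊ (evens r) A × δ₋ (odds r) A

𝒜₊ : RepSpace (lsuc Level.zero)
𝒜₊ = record { Carrier = Pred ; δ = δ₊ }

𝒜 : RepSpace (lsuc Level.zero)
𝒜 = record { Carrier = Pred ; δ = δ𝒜 }

data ℕ∞ : Set where
  fin : ℕ → ℕ∞
  ∞   : ℕ∞

δℕ∞ : Baire → ℕ∞ → Set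
δℕ∞ p (fin n) = (∀ i → i < n → p i ≡ 0) × p n ≡ 1
δℕ∞ p ∞       = ∀ i → p i ≡ 0

ℕ∞-space : RepSpace Level.zero
ℕ∞-space = record { Carrier = ℕ∞ ; δ = δℕ∞ }

Cantor-space : RepSpace Level.zero
Cantor-space = record { Carrier = Cantor ; δ = λ p x → ∀ n → p n ≡ bit (x n) }

Shatters : Pred → List ℕ → Set
Shatters C A = ∀ (S : Cantor) → Σ Cantor λ B → C B × (∀ a → a ∈ A → B a ≡ S a)

ShatteredOfSize : Pred → ℕ → Set
ShatteredOfSize C n = Σ (List ℕ) λ A → Unique A × Shatters C A × length A ≡ n

-- VCdimIs C d : "VCdim(C) = d" (sup of sizes of shattered finite sets; VCdim(∅) = 0)
VCdimIs : Pred → ℕ∞ → Set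
VCdimIs C (fin n) =
  (∀ A → Unique A → Shatters C A → length A ≤ n) × (n ≡ 0 ⊎ ShatteredOfSize C n)
VCdimIs C ∞ = ∀ m → Σ ℕ λ k → m ≤ k × ShatteredOfSize C k

VCdim : Prob (lsuc Level.zero) Level.zero
VCdim = prob 𝒜 ℕ∞-space VCdimIs

VCdim⁺ : Prob (lsuc Level.zero) Level.zero
VCdim⁺ = prob 𝒜₊ ℕ∞-space VCdimIs

countZeros : Cantor → ℕ → ℕ
countZeros x zero    = 0
countZeros x (suc N) = countZeros x N + (if x N then 0 else 1)

InfZeros : Cantor → Set
InfZeros x = ∀ m → Σ ℕ λ k → m ≤ k × x k ≡ false

ExactlyZeros : ℕ → Cantor → Set
ExactlyZeros n x = Σ ℕ λ N → countZeros x N ≡ n × (∀ k → N ≤ k → x k ≡ true)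

SORTrel : Problem Cantor-space Cantor-space
SORTrel x y =
  (InfZeros x × (∀ k → y k ≡ false)) ⊎
  (Σ ℕ λ n → ExactlyZeros n x × (∀ k → y k ≡ (if k <ᵇ n then false else true)))

SORT : Prob Level.zero Level.zero
SORT = prob Cantor-space Cantor-space SORTrel

{-# OPTIONS --safe #-}
module Submission where

-- VCdim ≤ VCdim⁺ forgets the negative information.  SORT ≤ VCdim maps x to the class of
-- all subsets of its zero set: a finite set is shattered by it iff it consists of zeros of
-- x, so its VC dimension is the number of zeros, and the class has a computable name since
-- B_n meets it iff every 1 of w_n sits at a 0 of x.  VCdim⁺ ≤ SORT searches the positive
-- name of A for shattered sets (a finite set is shattered iff each of its patterns is
-- realised by a listed basic set, which shows up at a finite stage) and emits a 0 whenever
-- one larger than all those found before appears.  The number of zeros of this sequence is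
-- VCdim(A), and SORT's answer 0ⁿ1^ω or 0^ω is itself a name of it in ℕ∞.  All maps involved
-- are primitive recursive, so the reductions compose.

open import Defs
open import Level using (0ℓ) renaming (suc to lsuc; _⊔_ to _⊔ℓ_)
open import Function using (_∘_)
open import Data.Empty using (⊥-elim)
open import Data.Unit using (tt)
open import Data.Product using (Σ; _×_; _,_; proj₁; proj₂)
open import Data.Sum using (_⊎_; inj₁; inj₂)
open import Data.Bool using (Bool; true; false; _∧_; _∨_; not; T; if_then_else_)
open import Data.Bool.Properties
  using (not-involutive; not-injective; ∧-zeroʳ; ∧-identityʳ; ∨-zeroʳ; ∧-conicalˡ; ∧-conicalʳ)
open import Data.Maybe using (Maybe; just; nothing; is-just; fromMaybe)
open import Data.Nat
  using (ℕ; zero; suc; pred; _+_; _*_; _∸_; _^_; _⊔_; _%_; _/_; ⌊_/2⌋; _≡ᵇ_; _<ᵇ_; _≟_; _≤_; _<_; z≤n; s≤s)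
open import Data.Nat.Properties
  using ( suc-injective; +-identityʳ; +-comm; +-suc; pred[m∸n]≡m∸[1+n]; <ᵇ⇒<; _≤?_; _<?_
        ; ≤-refl; ≤-reflexive; ≤-trans; ≤-antisym; ≤-pred; <-irrefl; ≰⇒>; ≮⇒≥; 1+n≰n
        ; n≤1+n; m≤m+n; m≤n+m; m≤n⇒m≤1+n; m≤n⇒m<n∨m≡n; m≤n⇒m⊓n≡m; m≤m⊔n; m≤n⊔m
        ; +-monoˡ-≤; module ≤-Reasoning)
open import Data.Nat.DivMod using ([m+n]%n≡m%n; m/n≡1+[m∸n]/n)
open import Data.Nat.GeneralisedArithmetic using (fold; iterate; iterate-is-fold)
open import Data.Fin using (Fin; #_) renaming (zero to fzero; suc to fsuc)
open import Data.Vec using (Vec; []; _∷_; tabulate)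
import Data.Vec as Vec
open import Data.Vec.Properties using (tabulate∘lookup)
open import Data.List using (List; []; _∷_; length; take)
open import Data.List.Properties using (length-take)
open import Data.List.Extrema.Nat using (max; xs≤max)
open import Data.List.Membership.Propositional using (_∈_; find)
open import Data.List.Membership.DecPropositional _≟_ using (_∈?_)
open import Data.List.Relation.Unary.Any using (here; there; any?)
open import Data.List.Relation.Unary.All as All using (All)
open import Data.List.Relation.Unary.All.Properties using (¬Any⇒All¬)
open import Data.List.Relation.Unary.AllPairs using ([]; _∷_)
open import Data.List.Relation.Unary.Unique.Propositional using (Unique)
open import Data.List.Relation.Unary.Unique.Propositional.Properties using (take⁺)
open import Data.List.Relation.Binary.Sublist.Propositional using (lookup)
open import Data.List.Relation.Binary.Sublist.Propositional.Properties using (take-⊆)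
open import Relation.Nullary using (¬_; does; yes; no)
open import Relation.Nullary.Decidable using (dec-true; dec-false)
open import Relation.Binary.PropositionalEquality
  using (_≡_; _≢_; refl; sym; trans; cong; cong₂; subst; _≗_; module ≡-Reasoning)

-- Primitive recursive programs

-- The μ-free fragment of PR: its programs are total, so they can be run by a
-- function instead of the relation Eval.
data Prim : ℕ → Set where
  Z : ∀ {n} → Prim n
  S : Prim 1
  P : ∀ {n} → Fin n → Prim n
  O : Prim 1
  C : ∀ {m n} → Prim m → Vec (Prim n) m → Prim n
  R : ∀ {n} → Prim n → Prim (suc (suc n)) → Prim (suc n)

⌜_⌝ : ∀ {n} → Prim n → PR n
⌜_⌝* : ∀ {n m} → Vec (Prim n) m → Vec (PR n) m
⌜ Z ⌝ = pzero
⌜ S ⌝ = psucc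
⌜ P i ⌝ = pproj i
⌜ O ⌝ = poracle
⌜ C f gs ⌝ = pcomp ⌜ f ⌝ ⌜ gs ⌝*
⌜ R g h ⌝ = pprec ⌜ g ⌝ ⌜ h ⌝
⌜ [] ⌝* = []
⌜ g ∷ gs ⌝* = ⌜ g ⌝ ∷ ⌜ gs ⌝*

eval : ∀ {n} → Prim n → Baire → Vec ℕ n → ℕ
evalAll : ∀ {n m} → Vec (Prim n) m → Baire → Vec ℕ n → Vec ℕ m
evalRec : ∀ {n} → Prim n → Prim (suc (suc n)) → Baire → ℕ → Vec ℕ n → ℕ
eval Z α xs = 0
eval S α (x ∷ []) = suc x
eval (P i) α xs = Vec.lookup xs i
eval O α (x ∷ []) = α x
eval (C f gs) α xs = eval f α (evalAll gs α xs)
eval (R g h) α (k ∷ xs) = evalRec g h α k xs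
evalRec g h α zero xs = eval g α xs
evalRec g h α (suc k) xs = eval h α (k ∷ evalRec g h α k xs ∷ xs)
evalAll [] α xs = []
evalAll (g ∷ gs) α xs = eval g α xs ∷ evalAll gs α xs

eval-sound : ∀ {n} (e : Prim n) α xs → Eval ⌜ e ⌝ α xs (eval e α xs)
evalAll-sound : ∀ {n m} (gs : Vec (Prim n) m) α xs → EvalAll ⌜ gs ⌝* α xs (evalAll gs α xs)
evalRec-sound : ∀ {n} (g : Prim n) h α k xs →
                Eval (pprec ⌜ g ⌝ ⌜ h ⌝) α (k ∷ xs) (evalRec g h α k xs)
eval-sound Z α xs = ev-zero
eval-sound S α (x ∷ []) = ev-succ
eval-sound (P i) α xs = ev-proj i
eval-sound O α (x ∷ []) = ev-oracle
eval-sound (C f gs) α xs = ev-comp (evalAll-sound gs α xs) (eval-sound f α _)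
eval-sound (R g h) α (k ∷ xs) = evalRec-sound g h α k xs
evalRec-sound g h α zero xs = ev-prec0 (eval-sound g α xs)
evalRec-sound g h α (suc k) xs = ev-precS (evalRec-sound g h α k xs) (eval-sound h α _)
evalAll-sound [] α xs = ev-[]
evalAll-sound (g ∷ gs) α xs = ev-∷ (eval-sound g α xs) (evalAll-sound gs α xs)

eval-cong : ∀ {n} (e : Prim n) {α β} → α ≗ β → ∀ xs → eval e α xs ≡ eval e β xs
evalAll-cong : ∀ {n m} (gs : Vec (Prim n) m) {α β} → α ≗ β → ∀ xs →
               evalAll gs α xs ≡ evalAll gs β xs
evalRec-cong : ∀ {n} (g : Prim n) h {α β} → α ≗ β → ∀ k xs →
               evalRec g h α k xs ≡ evalRec g h β k xs
eval-cong Z α≗β xs = refl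
eval-cong S α≗β (x ∷ []) = refl
eval-cong (P i) α≗β xs = refl
eval-cong O α≗β (x ∷ []) = α≗β x
eval-cong (C f gs) {α} α≗β xs =
  trans (cong (eval f α) (evalAll-cong gs α≗β xs)) (eval-cong f α≗β _)
eval-cong (R g h) α≗β (k ∷ xs) = evalRec-cong g h α≗β k xs
evalRec-cong g h α≗β zero xs = eval-cong g α≗β xs
evalRec-cong g h {α} α≗β (suc k) xs =
  trans (cong (λ v → eval h α (k ∷ v ∷ xs)) (evalRec-cong g h α≗β k xs)) (eval-cong h α≗β _)
evalAll-cong [] α≗β xs = refl
evalAll-cong (g ∷ gs) α≗β xs = cong₂ _∷_ (eval-cong g α≗β xs) (evalAll-cong gs α≗β xs)

⟦_⟧ : Prim 1 → Baire → Baire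
⟦ e ⟧ α n = eval e α (n ∷ [])

_[O≔_] : ∀ {n} → Prim n → Prim 1 → Prim n
_[O≔_]* : ∀ {n m} → Vec (Prim n) m → Prim 1 → Vec (Prim n) m
Z [O≔ k ] = Z
S [O≔ k ] = S
P i [O≔ k ] = P i
O [O≔ k ] = k
C f gs [O≔ k ] = C (f [O≔ k ]) (gs [O≔ k ]*)
R g h [O≔ k ] = R (g [O≔ k ]) (h [O≔ k ])
[] [O≔ k ]* = []
(g ∷ gs) [O≔ k ]* = g [O≔ k ] ∷ gs [O≔ k ]*

eval-[O≔] : ∀ {n} (e : Prim n) k α xs → eval (e [O≔ k ]) α xs ≡ eval e (⟦ k ⟧ α) xs
evalAll-[O≔] : ∀ {n m} (gs : Vec (Prim n) m) k α xs →
               evalAll (gs [O≔ k ]*) α xs ≡ evalAll gs (⟦ k ⟧ α) xs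
evalRec-[O≔] : ∀ {n} (g : Prim n) h k α j xs →
               evalRec (g [O≔ k ]) (h [O≔ k ]) α j xs ≡ evalRec g h (⟦ k ⟧ α) j xs
eval-[O≔] Z k α xs = refl
eval-[O≔] S k α (x ∷ []) = refl
eval-[O≔] (P i) k α xs = refl
eval-[O≔] O k α (x ∷ []) = refl
eval-[O≔] (C f gs) k α xs =
  trans (cong (eval (f [O≔ k ]) α) (evalAll-[O≔] gs k α xs)) (eval-[O≔] f k α _)
eval-[O≔] (R g h) k α (j ∷ xs) = evalRec-[O≔] g h k α j xs
evalRec-[O≔] g h k α zero xs = eval-[O≔] g k α xs
evalRec-[O≔] g h k α (suc j) xs =
  trans (cong (λ v → eval (h [O≔ k ]) α (j ∷ v ∷ xs)) (evalRec-[O≔] g h k α j xs))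
        (eval-[O≔] h k α _)
evalAll-[O≔] [] k α xs = refl
evalAll-[O≔] (g ∷ gs) k α xs = cong₂ _∷_ (eval-[O≔] g k α xs) (evalAll-[O≔] gs k α xs)

PrimComputable : (Baire → Baire) → Set
PrimComputable F = Σ (Prim 1) λ e → ∀ α → ⟦ e ⟧ α ≗ F α

PrimComputable-id : PrimComputable (λ α → α)
PrimComputable-id = O , λ α n → refl

PrimComputable-∘ : ∀ {F G} → PrimComputable F → PrimComputable G →
                   PrimComputable (λ α → G (F α))
PrimComputable-∘ {F} {G} (eF , eF≗F) (eG , eG≗G) = eG [O≔ eF ] , λ α n → begin
  ⟦ eG [O≔ eF ] ⟧ α n  ≡⟨ eval-[O≔] eG eF α (n ∷ []) ⟩
  ⟦ eG ⟧ (⟦ eF ⟧ α) n  ≡⟨ eval-cong eG (eF≗F α) (n ∷ []) ⟩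
  ⟦ eG ⟧ (F α) n       ≡⟨ eG≗G (F α) n ⟩
  G (F α) n            ∎
  where open ≡-Reasoning

record _≤ᵖʳ_ {a b c d} (f : Prob a b) (g : Prob c d) : Set (lsuc 0ℓ ⊔ℓ a ⊔ℓ b ⊔ℓ c ⊔ℓ d) where
  field
    pre post        : Baire → Baire
    pre-computable  : PrimComputable pre
    post-computable : PrimComputable post
    translate : ∀ p x → δ (In f) p x →
      Σ (Carrier (In g)) λ x' → δ (In g) (pre p) x' ×
        (∀ q y' → δ (Out g) q y' → rel g x' y' →
           Σ (Carrier (Out f)) λ y → δ (Out f) (post q) y × rel f x y)

≤ᵖʳ-trans : ∀ {a b c d e e'} {f : Prob a b} {g : Prob c d} {h : Prob e e'} →
            f ≤ᵖʳ g → g ≤ᵖʳ h → f ≤ᵖʳ h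
≤ᵖʳ-trans f≤g g≤h = record
  { pre = λ p → pre g≤h (pre f≤g p)
  ; post = λ q → post f≤g (post g≤h q)
  ; pre-computable = PrimComputable-∘ (pre-computable f≤g) (pre-computable g≤h)
  ; post-computable = PrimComputable-∘ (post-computable g≤h) (post-computable f≤g)
  ; translate = λ p x px →
      let (x' , px' , back) = translate f≤g p x px
          (x'' , px'' , back') = translate g≤h (pre f≤g p) x' px'
      in x'' , px'' , λ q y'' qy'' sol'' →
           let (y' , qy' , sol') = back' q y'' qy'' sol'' in back (post g≤h q) y' qy' sol'
  }
  where open _≤ᵖʳ_

≤ᵖʳ⇒≤sW : ∀ {a b c d} {f : Prob a b} {g : Prob c d} → f ≤ᵖʳ g → f ≤sW g
≤ᵖʳ⇒≤sW r = ⌜ proj₁ post-computable ⌝ , ⌜ proj₁ pre-computable ⌝ , λ G G-realizes p x px →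
  let (x' , px' , back) = translate p x px
      (q , Gq , y' , qy' , sol') = G-realizes (pre p) x' px'
      (y , post-q-y , sol) = back q y' qy' sol'
  in pre p , computes pre-computable p , q , Gq , post q , computes post-computable q ,
     y , post-q-y , sol
  where
  open _≤ᵖʳ_ r
  computes : ∀ {F} (F-computable : PrimComputable F) α → Computes ⌜ proj₁ F-computable ⌝ α (F α)
  computes (e , e≗F) α n = subst (Eval ⌜ e ⌝ α (n ∷ [])) (e≗F α n) (eval-sound e α (n ∷ []))

evalAll-tabulate : ∀ {n m} (g : Fin m → Prim n) α xs →
                   evalAll (tabulate g) α xs ≡ tabulate (λ i → eval (g i) α xs)
evalAll-tabulate {m = zero} g α xs = refl
evalAll-tabulate {m = suc m} g α xs =
  cong (eval (g fzero) α xs ∷_) (evalAll-tabulate (λ i → g (fsuc i)) α xs)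

projs : ∀ {n} → Vec (Prim n) n
projs = tabulate P

evalAll-projs : ∀ {n} α (xs : Vec ℕ n) → evalAll projs α xs ≡ xs
evalAll-projs α xs = trans (evalAll-tabulate P α xs) (tabulate∘lookup xs)

drop₂ : ∀ {n} → Vec (Prim (suc (suc n))) n
drop₂ = tabulate (λ i → P (fsuc (fsuc i)))

evalAll-drop₂ : ∀ {n} α x y (xs : Vec ℕ n) → evalAll drop₂ α (x ∷ y ∷ xs) ≡ xs
evalAll-drop₂ α x y xs =
  trans (evalAll-tabulate (λ i → P (fsuc (fsuc i))) α (x ∷ y ∷ xs)) (tabulate∘lookup xs)

lit : ∀ {n} → ℕ → Prim n
lit zero = Z
lit (suc k) = C S (lit k ∷ [])

O[_] : ∀ {n} → Prim n → Prim n
O[ a ] = C O (a ∷ [])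

ifZero : ℕ → ℕ → ℕ → ℕ
ifZero zero    a b = a
ifZero (suc _) a b = b

ifZeroᵖ : ∀ {n} → Prim n → Prim n → Prim n → Prim n
ifZeroᵖ c a b = C (R a (C b drop₂)) (c ∷ projs)

eval-ifZeroᵖ : ∀ {n} (c a b : Prim n) α xs →
               eval (ifZeroᵖ c a b) α xs ≡ ifZero (eval c α xs) (eval a α xs) (eval b α xs)
eval-ifZeroᵖ c a b α xs with eval c α xs
... | zero  = cong (eval a α) (evalAll-projs α xs)
... | suc k = cong (eval b α) (trans (evalAll-drop₂ α k _ (evalAll projs α xs)) (evalAll-projs α xs))

ifZero-bit : ∀ b {a c} → ifZero (bit b) a c ≡ (if b then c else a)
ifZero-bit false = refl
ifZero-bit true  = refl

notᵖ nonZeroᵖ : ∀ {n} → Prim n → Prim n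
notᵖ a = ifZeroᵖ a (lit 1) (lit 0)
nonZeroᵖ a = ifZeroᵖ a (lit 0) (lit 1)

_∧ᵖ_ _∨ᵖ_ : ∀ {n} → Prim n → Prim n → Prim n
a ∧ᵖ b = ifZeroᵖ a (lit 0) b
a ∨ᵖ b = ifZeroᵖ a b (lit 1)

predᵖ : ∀ {n} → Prim n → Prim n
predᵖ a = C (R Z (P (# 0))) (a ∷ [])

eval-predᵖ : ∀ {n} α (xs : Vec ℕ n) a → eval (predᵖ a) α xs ≡ pred (eval a α xs)
eval-predᵖ α xs a with eval a α xs
... | zero  = refl
... | suc _ = refl

_+ᵖ_ _∸ᵖ_ : ∀ {n} → Prim n → Prim n → Prim n
a +ᵖ b = C (R (P (# 0)) (C S (P (# 1) ∷ []))) (a ∷ b ∷ [])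
a ∸ᵖ b = C (R (P (# 0)) (predᵖ (P (# 1)))) (b ∷ a ∷ [])

_≡ᵖ_ _<ᵖ_ : ∀ {n} → Prim n → Prim n → Prim n
a ≡ᵖ b = notᵖ ((a ∸ᵖ b) +ᵖ (b ∸ᵖ a))
a <ᵖ b = nonZeroᵖ (b ∸ᵖ a)

odd : ℕ → Bool
odd zero = false
odd (suc n) = not (odd n)

oddᵖ halfᵖ 2^ᵖ : ∀ {n} → Prim n → Prim n
oddᵖ a = C (R Z (notᵖ (P (# 1)))) (a ∷ [])
halfᵖ a = C (R Z (P (# 1) +ᵖ oddᵖ (P (# 0)))) (a ∷ [])
2^ᵖ a = C (R (lit 1) (P (# 1) +ᵖ P (# 1))) (a ∷ [])

module _ {n} (α : Baire) (xs : Vec ℕ n) where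

  eval-notᵖ : ∀ a {A} → eval a α xs ≡ bit A → eval (notᵖ a) α xs ≡ bit (not A)
  eval-notᵖ a {false} a≡A rewrite eval-ifZeroᵖ a (lit 1) (lit 0) α xs | a≡A = refl
  eval-notᵖ a {true}  a≡A rewrite eval-ifZeroᵖ a (lit 1) (lit 0) α xs | a≡A = refl

  eval-∧ᵖ : ∀ a b {A B} → eval a α xs ≡ bit A → eval b α xs ≡ bit B →
            eval (a ∧ᵖ b) α xs ≡ bit (A ∧ B)
  eval-∧ᵖ a b {false} a≡A b≡B rewrite eval-ifZeroᵖ a (lit 0) b α xs | a≡A = refl
  eval-∧ᵖ a b {true}  a≡A b≡B rewrite eval-ifZeroᵖ a (lit 0) b α xs | a≡A = b≡B

  eval-∨ᵖ : ∀ a b {A B} → eval a α xs ≡ bit A → eval b α xs ≡ bit B →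
            eval (a ∨ᵖ b) α xs ≡ bit (A ∨ B)
  eval-∨ᵖ a b {false} a≡A b≡B rewrite eval-ifZeroᵖ a b (lit 1) α xs | a≡A = b≡B
  eval-∨ᵖ a b {true}  a≡A b≡B rewrite eval-ifZeroᵖ a b (lit 1) α xs | a≡A = refl

  eval-nonZeroᵖ : ∀ a → eval (nonZeroᵖ a) α xs ≡ bit (0 <ᵇ eval a α xs)
  eval-nonZeroᵖ a rewrite eval-ifZeroᵖ a (lit 0) (lit 1) α xs with eval a α xs
  ... | zero  = refl
  ... | suc _ = refl

  eval-+ᵖ : ∀ a b → eval (a +ᵖ b) α xs ≡ eval a α xs + eval b α xs
  eval-+ᵖ a b = add (eval a α xs) (eval b α xs)
    where
    add : ∀ x y → eval (R (P (# 0)) (C S (P (# 1) ∷ []))) α (x ∷ y ∷ []) ≡ x + y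
    add zero    y = refl
    add (suc x) y = cong suc (add x y)

  eval-∸ᵖ : ∀ a b → eval (a ∸ᵖ b) α xs ≡ eval a α xs ∸ eval b α xs
  eval-∸ᵖ a b = monus (eval b α xs) (eval a α xs)
    where
    monus : ∀ y x → eval (R (P (# 0)) (predᵖ (P (# 1)))) α (y ∷ x ∷ []) ≡ x ∸ y
    monus zero    x = refl
    monus (suc y) x =
      trans (eval-predᵖ α (y ∷ eval (R (P (# 0)) (predᵖ (P (# 1)))) α (y ∷ x ∷ []) ∷ x ∷ []) (P (# 1)))
            (trans (cong pred (monus y x)) (pred[m∸n]≡m∸[1+n] x y))

  eval-≡ᵖ : ∀ a b → eval (a ≡ᵖ b) α xs ≡ bit (eval a α xs ≡ᵇ eval b α xs)
  eval-≡ᵖ a b = begin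
    eval (a ≡ᵖ b) α xs                          ≡⟨ eval-ifZeroᵖ ((a ∸ᵖ b) +ᵖ (b ∸ᵖ a)) (lit 1) (lit 0) α xs ⟩
    ifZero (eval ((a ∸ᵖ b) +ᵖ (b ∸ᵖ a)) α xs) 1 0 ≡⟨ cong (λ v → ifZero v 1 0) distance ⟩
    ifZero ((x ∸ y) + (y ∸ x)) 1 0              ≡⟨ distance-zero x y ⟩
    bit (x ≡ᵇ y)                                ∎
    where
    open ≡-Reasoning
    x y : ℕ
    x = eval a α xs
    y = eval b α xs
    distance : eval ((a ∸ᵖ b) +ᵖ (b ∸ᵖ a)) α xs ≡ (x ∸ y) + (y ∸ x)
    distance = trans (eval-+ᵖ (a ∸ᵖ b) (b ∸ᵖ a)) (cong₂ _+_ (eval-∸ᵖ a b) (eval-∸ᵖ b a))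
    distance-zero : ∀ x y → ifZero ((x ∸ y) + (y ∸ x)) 1 0 ≡ bit (x ≡ᵇ y)
    distance-zero zero    zero    = refl
    distance-zero zero    (suc y) = refl
    distance-zero (suc x) zero    = refl
    distance-zero (suc x) (suc y) = distance-zero x y

  eval-<ᵖ : ∀ a b → eval (a <ᵖ b) α xs ≡ bit (eval a α xs <ᵇ eval b α xs)
  eval-<ᵖ a b = trans (eval-nonZeroᵖ (b ∸ᵖ a))
    (cong bit (trans (cong (0 <ᵇ_) (eval-∸ᵖ b a)) (0<ᵇ∸ (eval a α xs) (eval b α xs))))
    where
    0<ᵇ∸ : ∀ x y → (0 <ᵇ y ∸ x) ≡ (x <ᵇ y)
    0<ᵇ∸ zero    zero    = refl
    0<ᵇ∸ zero    (suc y) = refl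
    0<ᵇ∸ (suc x) zero    = refl
    0<ᵇ∸ (suc x) (suc y) = 0<ᵇ∸ x y

⌊1+n/2⌋≡⌊n/2⌋+odd : ∀ n → ⌊ suc n /2⌋ ≡ ⌊ n /2⌋ + bit (odd n)
⌊1+n/2⌋≡⌊n/2⌋+odd zero = refl
⌊1+n/2⌋≡⌊n/2⌋+odd (suc zero) = refl
⌊1+n/2⌋≡⌊n/2⌋+odd (suc (suc n)) rewrite not-involutive (odd n) = cong suc (⌊1+n/2⌋≡⌊n/2⌋+odd n)

eval-oddᵖ : ∀ {n} α (xs : Vec ℕ n) a → eval (oddᵖ a) α xs ≡ bit (odd (eval a α xs))
eval-oddᵖ α xs a = go (eval a α xs)
  where
  go : ∀ k → eval (oddᵖ (P (# 0))) α (k ∷ []) ≡ bit (odd k)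
  go zero    = refl
  go (suc k) = eval-notᵖ α (k ∷ _ ∷ []) (P (# 1)) (go k)

eval-halfᵖ : ∀ {n} α (xs : Vec ℕ n) a → eval (halfᵖ a) α xs ≡ ⌊ eval a α xs /2⌋
eval-halfᵖ α xs a = go (eval a α xs)
  where
  go : ∀ k → eval (halfᵖ (P (# 0))) α (k ∷ []) ≡ ⌊ k /2⌋
  go zero    = refl
  go (suc k) = begin
    eval (P (# 1) +ᵖ oddᵖ (P (# 0))) α (k ∷ r ∷ [])
      ≡⟨ eval-+ᵖ α (k ∷ r ∷ []) (P (# 1)) (oddᵖ (P (# 0))) ⟩
    r + eval (oddᵖ (P (# 0))) α (k ∷ r ∷ [])
      ≡⟨ cong₂ _+_ (go k) (eval-oddᵖ α (k ∷ r ∷ []) (P (# 0))) ⟩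
    ⌊ k /2⌋ + bit (odd k)
      ≡⟨ ⌊1+n/2⌋≡⌊n/2⌋+odd k ⟨
    ⌊ suc k /2⌋
      ∎
    where
    open ≡-Reasoning
    r : ℕ
    r = eval (halfᵖ (P (# 0))) α (k ∷ [])

eval-2^ᵖ : ∀ {n} α (xs : Vec ℕ n) a → eval (2^ᵖ a) α xs ≡ 2 ^ eval a α xs
eval-2^ᵖ α xs a = go (eval a α xs)
  where
  go : ∀ k → eval (2^ᵖ (P (# 0))) α (k ∷ []) ≡ 2 ^ k
  go zero    = refl
  go (suc k) = trans (eval-+ᵖ α (k ∷ r ∷ []) (P (# 1)) (P (# 1)))
                     (trans (cong (λ v → v + v) (go k)) (cong (2 ^ k +_) (sym (+-identityʳ (2 ^ k)))))
    where
    r : ℕ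
    r = eval (2^ᵖ (P (# 0))) α (k ∷ [])

anyBelow allBelow : (ℕ → Bool) → ℕ → Bool
anyBelow Q zero    = false
anyBelow Q (suc k) = anyBelow Q k ∨ Q k
allBelow Q zero    = true
allBelow Q (suc k) = allBelow Q k ∧ Q k

sumBelow : (ℕ → ℕ) → ℕ → ℕ
sumBelow f zero    = 0
sumBelow f (suc k) = sumBelow f k + f k

-- the body of a bounded loop sees the loop index but not the accumulator
loopBody : ∀ {n} → Prim (suc n) → Prim (suc (suc n))
loopBody body = C body (P (# 0) ∷ drop₂)

anyBelowᵖ allBelowᵖ sumBelowᵖ : ∀ {n} → Prim n → Prim (suc n) → Prim n
anyBelowᵖ b body = C (R Z       (P (# 1) ∨ᵖ loopBody body)) (b ∷ projs)
allBelowᵖ b body = C (R (lit 1) (P (# 1) ∧ᵖ loopBody body)) (b ∷ projs)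
sumBelowᵖ b body = C (R Z       (P (# 1) +ᵖ loopBody body)) (b ∷ projs)

module _ {n} (α : Baire) (xs : Vec ℕ n) (b : Prim n) (body : Prim (suc n)) where

  private
    eval-loopBody : ∀ k acc → eval (loopBody body) α (k ∷ acc ∷ xs) ≡ eval body α (k ∷ xs)
    eval-loopBody k acc = cong (λ v → eval body α (k ∷ v)) (evalAll-drop₂ α k acc xs)

    loop : ∀ {z} step → eval (C (R z step) (b ∷ projs)) α xs ≡ evalRec z step α (eval b α xs) xs
    loop step = cong (evalRec _ step α (eval b α xs)) (evalAll-projs α xs)

  eval-anyBelowᵖ : ∀ Q → (∀ i → eval body α (i ∷ xs) ≡ bit (Q i)) →
                   eval (anyBelowᵖ b body) α xs ≡ bit (anyBelow Q (eval b α xs))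
  eval-anyBelowᵖ Q body≡Q = trans (loop _) (go (eval b α xs))
    where
    go : ∀ k → evalRec Z (P (# 1) ∨ᵖ loopBody body) α k xs ≡ bit (anyBelow Q k)
    go zero    = refl
    go (suc k) = eval-∨ᵖ α _ (P (# 1)) (loopBody body) (go k)
                   (trans (eval-loopBody k _) (body≡Q k))

  eval-allBelowᵖ : ∀ Q → (∀ i → eval body α (i ∷ xs) ≡ bit (Q i)) →
                   eval (allBelowᵖ b body) α xs ≡ bit (allBelow Q (eval b α xs))
  eval-allBelowᵖ Q body≡Q = trans (loop _) (go (eval b α xs))
    where
    go : ∀ k → evalRec (lit 1) (P (# 1) ∧ᵖ loopBody body) α k xs ≡ bit (allBelow Q k)
    go zero    = refl
    go (suc k) = eval-∧ᵖ α _ (P (# 1)) (loopBody body) (go k)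
                   (trans (eval-loopBody k _) (body≡Q k))

  eval-sumBelowᵖ : ∀ f → (∀ i → eval body α (i ∷ xs) ≡ f i) →
                   eval (sumBelowᵖ b body) α xs ≡ sumBelow f (eval b α xs)
  eval-sumBelowᵖ f body≡f = trans (loop _) (go (eval b α xs))
    where
    go : ∀ k → evalRec Z (P (# 1) +ᵖ loopBody body) α k xs ≡ sumBelow f k
    go zero    = refl
    go (suc k) = trans (eval-+ᵖ α _ (P (# 1)) (loopBody body))
                       (cong₂ _+_ (go k) (trans (eval-loopBody k _) (body≡f k)))

_‼_ : List Bool → ℕ → Maybe Bool
[]      ‼ i     = nothing
(b ∷ w) ‼ zero  = just b
(b ∷ w) ‼ suc i = w ‼ i

m%2≡ᵇ1≡odd : ∀ m → (m % 2 ≡ᵇ 1) ≡ odd m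
m%2≡ᵇ1≡odd zero = refl
m%2≡ᵇ1≡odd (suc zero) = refl
m%2≡ᵇ1≡odd (suc (suc m)) = begin
  (suc (suc m) % 2 ≡ᵇ 1) ≡⟨ cong (λ v → v ≡ᵇ 1) (trans (cong (_% 2) (+-comm 2 m)) ([m+n]%n≡m%n m 2)) ⟩
  (m % 2 ≡ᵇ 1)           ≡⟨ m%2≡ᵇ1≡odd m ⟩
  odd m                  ≡⟨ not-involutive (odd m) ⟨
  odd (suc (suc m))      ∎
  where open ≡-Reasoning

m/2≡⌊m/2⌋ : ∀ m → m / 2 ≡ ⌊ m /2⌋
m/2≡⌊m/2⌋ zero = refl
m/2≡⌊m/2⌋ (suc zero) = refl
m/2≡⌊m/2⌋ (suc (suc m)) =
  trans (m/n≡1+[m∸n]/n {suc (suc m)} {2} (s≤s (s≤s z≤n))) (cong suc (m/2≡⌊m/2⌋ m))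

-- Letter i of decodeWord f m is read off the i-th iterate of m ↦ ⌊ (m ∸ 1) /2⌋.
shiftCode : ℕ → ℕ
shiftCode m = ⌊ pred m /2⌋

letterOfCode : ℕ → ℕ → ℕ → Maybe Bool
letterOfCode f m i =
  if (i <ᵇ f) ∧ (0 <ᵇ iterate shiftCode m i) then just (odd (pred (iterate shiftCode m i))) else nothing

iterate-shiftCode-0 : ∀ i → iterate shiftCode 0 i ≡ 0
iterate-shiftCode-0 zero    = refl
iterate-shiftCode-0 (suc i) = iterate-shiftCode-0 i

decodeWord-‼ : ∀ f m i → decodeWord f m ‼ i ≡ letterOfCode f m i
decodeWord-‼ zero m i = refl
decodeWord-‼ (suc f) zero i
  rewrite iterate-shiftCode-0 i | ∧-zeroʳ (i <ᵇ suc f) = refl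
decodeWord-‼ (suc f) (suc m) zero = cong just (m%2≡ᵇ1≡odd m)
decodeWord-‼ (suc f) (suc m) (suc i) =
  trans (decodeWord-‼ f (m / 2) i) (cong (λ v → letterOfCode f v i) (m/2≡⌊m/2⌋ m))

definedAt oneAt : ℕ → ℕ → Bool
definedAt c i = is-just (word c ‼ i)
oneAt c i = fromMaybe false (word c ‼ i)

codeAfterᵖ definedAtᵖ oneAtᵖ : Prim 2
codeAfterᵖ = C (R (P (# 0)) (halfᵖ (predᵖ (P (# 1))))) (P (# 1) ∷ P (# 0) ∷ [])
definedAtᵖ = (P (# 1) <ᵖ P (# 0)) ∧ᵖ nonZeroᵖ codeAfterᵖ
oneAtᵖ = definedAtᵖ ∧ᵖ oddᵖ (predᵖ codeAfterᵖ)

oneAt[_,_] definedAt[_,_] : ∀ {n} → Prim n → Prim n → Prim n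
oneAt[ c , i ] = C oneAtᵖ (c ∷ i ∷ [])
definedAt[ c , i ] = C definedAtᵖ (c ∷ i ∷ [])

module _ (α : Baire) (c i : ℕ) where

  private
    xs : Vec ℕ 2
    xs = c ∷ i ∷ []
    it : ℕ
    it = iterate shiftCode c i
    inWord : Bool
    inWord = (i <ᵇ c) ∧ (0 <ᵇ it)

    eval-codeAfterᵖ : eval codeAfterᵖ α xs ≡ it
    eval-codeAfterᵖ = trans (go i) (iterate-is-fold c shiftCode i)
      where
      go : ∀ k → evalRec (P (# 0)) (halfᵖ (predᵖ (P (# 1)))) α k (c ∷ []) ≡ fold c shiftCode k
      go zero    = refl
      go (suc k) = trans (eval-halfᵖ α ys (predᵖ (P (# 1))))
                         (cong ⌊_/2⌋ (trans (eval-predᵖ α ys (P (# 1))) (cong pred (go k))))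
        where
        ys : Vec ℕ 3
        ys = k ∷ evalRec (P (# 0)) (halfᵖ (predᵖ (P (# 1)))) α k (c ∷ []) ∷ c ∷ []

    eval-definedAtᵖ′ : eval definedAtᵖ α xs ≡ bit inWord
    eval-definedAtᵖ′ = eval-∧ᵖ α xs (P (# 1) <ᵖ P (# 0)) (nonZeroᵖ codeAfterᵖ)
      (eval-<ᵖ α xs (P (# 1)) (P (# 0)))
      (trans (eval-nonZeroᵖ α xs codeAfterᵖ) (cong (λ v → bit (0 <ᵇ v)) eval-codeAfterᵖ))

    is-just-if : ∀ A (v : Bool) → is-just (if A then just v else nothing) ≡ A
    is-just-if false v = refl
    is-just-if true  v = refl

    fromMaybe-if : ∀ A v → fromMaybe false (if A then just v else nothing) ≡ A ∧ v
    fromMaybe-if false v = refl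
    fromMaybe-if true  v = refl

  eval-definedAtᵖ : eval definedAtᵖ α (c ∷ i ∷ []) ≡ bit (definedAt c i)
  eval-definedAtᵖ = trans eval-definedAtᵖ′
    (cong bit (sym (trans (cong is-just (decodeWord-‼ c c i)) (is-just-if inWord (odd (pred it))))))

  eval-oneAtᵖ : eval oneAtᵖ α (c ∷ i ∷ []) ≡ bit (oneAt c i)
  eval-oneAtᵖ = trans
    (eval-∧ᵖ α xs definedAtᵖ (oddᵖ (predᵖ codeAfterᵖ)) eval-definedAtᵖ′
      (trans (eval-oddᵖ α xs (predᵖ codeAfterᵖ))
        (cong (bit ∘ odd) (trans (eval-predᵖ α xs codeAfterᵖ) (cong pred eval-codeAfterᵖ)))))
    (cong bit (sym (trans (cong (fromMaybe false) (decodeWord-‼ c c i)) (fromMaybe-if inWord (odd (pred it))))))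

double : ℕ → ℕ
double zero    = 0
double (suc n) = suc (suc (double n))

double≡2* : ∀ n → double n ≡ 2 * n
double≡2* zero    = refl
double≡2* (suc n) = cong suc (trans (cong suc (double≡2* n)) (sym (+-suc n (n + 0))))

encode : List Bool → ℕ
encode []      = 0
encode (b ∷ w) = suc (bit b + double (encode w))

odd-bit+double : ∀ b e → odd (bit b + double e) ≡ b
odd-bit+double false zero    = refl
odd-bit+double false (suc e) = trans (not-involutive _) (odd-bit+double false e)
odd-bit+double true  zero    = refl
odd-bit+double true  (suc e) = trans (not-involutive _) (odd-bit+double true e)

⌊bit+double/2⌋ : ∀ b e → ⌊ bit b + double e /2⌋ ≡ e
⌊bit+double/2⌋ false zero    = refl
⌊bit+double/2⌋ false (suc e) = cong suc (⌊bit+double/2⌋ false e)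
⌊bit+double/2⌋ true  zero    = refl
⌊bit+double/2⌋ true  (suc e) = cong suc (⌊bit+double/2⌋ true e)

decodeWord-encode : ∀ f w → length w ≤ f → decodeWord f (encode w) ≡ w
decodeWord-encode zero    []      _ = refl
decodeWord-encode (suc f) []      _ = refl
decodeWord-encode (suc f) (b ∷ w) (s≤s |w|≤f) = cong₂ _∷_
  (trans (m%2≡ᵇ1≡odd m) (odd-bit+double b (encode w)))
  (trans (cong (decodeWord f) (trans (m/2≡⌊m/2⌋ m) (⌊bit+double/2⌋ b (encode w))))
         (decodeWord-encode f w |w|≤f))
  where
  m : ℕ
  m = bit b + double (encode w)

n≤double : ∀ n → n ≤ double n
n≤double zero    = z≤n
n≤double (suc n) = s≤s (m≤n⇒m≤1+n (n≤double n))

length≤encode : ∀ w → length w ≤ encode w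
length≤encode []      = z≤n
length≤encode (b ∷ w) =
  s≤s (≤-trans (length≤encode w) (≤-trans (n≤double (encode w)) (m≤n+m _ (bit b))))

word-encode : ∀ w → word (encode w) ≡ w
word-encode w = decodeWord-encode (encode w) w (length≤encode w)

encode< : ∀ w → encode w < 2 ^ suc (length w)
encode< w = ≤-trans (n≤1+n _) (bound w)
  where
  double-mono : ∀ {m n} → m ≤ n → double m ≤ double n
  double-mono z≤n       = z≤n
  double-mono (s≤s m≤n) = s≤s (s≤s (double-mono m≤n))
  bit≤1 : ∀ b → bit b ≤ 1
  bit≤1 false = z≤n
  bit≤1 true  = s≤s z≤n
  bound : ∀ w → 2 + encode w ≤ 2 ^ suc (length w)
  bound []      = s≤s (s≤s z≤n)
  bound (b ∷ w) = begin
    3 + (bit b + double (encode w)) ≤⟨ s≤s (s≤s (s≤s (+-monoˡ-≤ (double (encode w)) (bit≤1 b)))) ⟩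
    double (2 + encode w)           ≤⟨ double-mono (bound w) ⟩
    double (2 ^ suc (length w))     ≡⟨ double≡2* _ ⟩
    2 ^ suc (suc (length w))        ∎
    where open ≤-Reasoning

length-decodeWord : ∀ f m → length (decodeWord f m) ≤ f
length-decodeWord zero    m       = z≤n
length-decodeWord (suc f) zero    = z≤n
length-decodeWord (suc f) (suc m) = s≤s (length-decodeWord f (m / 2))

‼-length : ∀ w i {b} → w ‼ i ≡ just b → i < length w
‼-length (_ ∷ w) zero    _ = s≤s z≤n
‼-length (_ ∷ w) (suc i) e = s≤s (‼-length w i e)

‼-beyond : ∀ w i → length w ≤ i → w ‼ i ≡ nothing
‼-beyond []      i       _           = refl
‼-beyond (b ∷ w) (suc i) (s≤s |w|≤i) = ‼-beyond w i |w|≤i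

word-‼-< : ∀ c i {b} → word c ‼ i ≡ just b → i < c
word-‼-< c i e = ≤-trans (‼-length (word c) i e) (length-decodeWord c c)

Prefix-‼ : ∀ w x i {b} → Prefix w x → w ‼ i ≡ just b → x i ≡ b
Prefix-‼ (c ∷ w) x zero    (x0≡c , _) refl = x0≡c
Prefix-‼ (c ∷ w) x (suc i) (_ , w≺x)  e    = Prefix-‼ w (x ∘ suc) i w≺x e

prefixOf : Cantor → ℕ → List Bool
prefixOf x zero    = []
prefixOf x (suc N) = x 0 ∷ prefixOf (x ∘ suc) N

Prefix-prefixOf : ∀ x N → Prefix (prefixOf x N) x
Prefix-prefixOf x zero    = tt
Prefix-prefixOf x (suc N) = refl , Prefix-prefixOf (x ∘ suc) N

prefixOf-‼ : ∀ x N i → i < N → prefixOf x N ‼ i ≡ just (x i)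
prefixOf-‼ x (suc N) zero    _         = refl
prefixOf-‼ x (suc N) (suc i) (s≤s i<N) = prefixOf-‼ (x ∘ suc) N i i<N

length-prefixOf : ∀ x N → length (prefixOf x N) ≡ N
length-prefixOf x zero    = refl
length-prefixOf x (suc N) = cong suc (length-prefixOf (x ∘ suc) N)

fromMaybe-just : ∀ (b : Bool) → fromMaybe false (just b) ≡ b
fromMaybe-just false = refl
fromMaybe-just true  = refl

fromMaybe-true : ∀ m → fromMaybe false m ≡ true → m ≡ just true
fromMaybe-true (just true) _ = refl

zeroExtension : List Bool → Cantor
zeroExtension w i = fromMaybe false (w ‼ i)

Prefix-zeroExtension : ∀ w → Prefix w (zeroExtension w)
Prefix-zeroExtension []      = tt
Prefix-zeroExtension (b ∷ w) = fromMaybe-just b , Prefix-zeroExtension w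

InB-encode-prefixOf : ∀ x N → InB (encode (prefixOf x N)) x
InB-encode-prefixOf x N = subst (λ w → Prefix w x) (sym (word-encode (prefixOf x N))) (Prefix-prefixOf x N)

word-encode-prefixOf-‼ : ∀ x N i → i < N → word (encode (prefixOf x N)) ‼ i ≡ just (x i)
word-encode-prefixOf-‼ x N i i<N = trans (cong (_‼ i) (word-encode (prefixOf x N))) (prefixOf-‼ x N i i<N)

<ᵇ-true⇒< : ∀ {m n} → (m <ᵇ n) ≡ true → m < n
<ᵇ-true⇒< {m} {n} m<ᵇn = <ᵇ⇒< m n (subst T (sym m<ᵇn) tt)

<⇒<ᵇ-true : ∀ {m n} → m < n → (m <ᵇ n) ≡ true
<⇒<ᵇ-true {m} {n} = dec-true (m <? n)

bit-≡ᵇ : ∀ a b → (bit a ≡ᵇ bit b) ≡ true → a ≡ b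
bit-≡ᵇ false false _ = refl
bit-≡ᵇ true  true  _ = refl

bit-≡ᵇ-refl : ∀ b → (bit b ≡ᵇ bit b) ≡ true
bit-≡ᵇ-refl false = refl
bit-≡ᵇ-refl true  = refl

anyBelow-intro : ∀ Q k i → i < k → Q i ≡ true → anyBelow Q k ≡ true
anyBelow-intro Q (suc k) i (s≤s i≤k) Qi with m≤n⇒m<n∨m≡n i≤k
... | inj₁ i<k  rewrite anyBelow-intro Q k i i<k Qi = refl
... | inj₂ refl rewrite Qi = ∨-zeroʳ (anyBelow Q i)

anyBelow-elim : ∀ Q k → anyBelow Q k ≡ true → Σ ℕ λ i → i < k × Q i ≡ true
anyBelow-elim Q (suc k) any with anyBelow Q k in anyₖ
... | true  = let (i , i<k , Qi) = anyBelow-elim Q k anyₖ in i , m≤n⇒m≤1+n i<k , Qi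
... | false = k , ≤-refl , any

anyBelow-false : ∀ Q k → (∀ i → i < k → Q i ≡ false) → anyBelow Q k ≡ false
anyBelow-false Q zero    none = refl
anyBelow-false Q (suc k) none
  rewrite anyBelow-false Q k (λ i i<k → none i (m≤n⇒m≤1+n i<k)) = none k ≤-refl

allBelow-intro : ∀ Q k → (∀ i → i < k → Q i ≡ true) → allBelow Q k ≡ true
allBelow-intro Q zero    every = refl
allBelow-intro Q (suc k) every
  rewrite allBelow-intro Q k (λ i i<k → every i (m≤n⇒m≤1+n i<k)) = every k ≤-refl

allBelow-elim : ∀ Q k → allBelow Q k ≡ true → ∀ i → i < k → Q i ≡ true
allBelow-elim Q (suc k) all i (s≤s i≤k) with m≤n⇒m<n∨m≡n i≤k
... | inj₁ i<k  = allBelow-elim Q k (∧-conicalˡ _ _ all) i i<k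
... | inj₂ refl = ∧-conicalʳ _ _ all

uniformBound : ∀ (G : ℕ → ℕ → Bool) K → (∀ e → e < K → Σ ℕ λ j → G e j ≡ true) →
               Σ ℕ λ M → ∀ e → e < K → Σ ℕ λ j → j < M × G e j ≡ true
uniformBound G zero    witness = 0 , λ e ()
uniformBound G (suc K) witness
  with uniformBound G K (λ e e<K → witness e (m≤n⇒m≤1+n e<K)) | witness K ≤-refl
... | M , belowM | j , Gj = M ⊔ suc j , bounded
  where
  bounded : ∀ e → e < suc K → Σ ℕ λ j′ → j′ < M ⊔ suc j × G e j′ ≡ true
  bounded e (s≤s e≤K) with m≤n⇒m<n∨m≡n e≤K
  ... | inj₁ e<K  = let (j′ , j′<M , Gj′) = belowM e e<K in j′ , ≤-trans j′<M (m≤m⊔n M (suc j)) , Gj′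
  ... | inj₂ refl = j , m≤n⊔m M (suc j) , Gj

countBelow : (ℕ → Bool) → ℕ → ℕ
countBelow Q = sumBelow (bit ∘ Q)

countBelow-cong : ∀ {Q Q′} m → (∀ i → i < m → Q i ≡ Q′ i) → countBelow Q m ≡ countBelow Q′ m
countBelow-cong zero    Q≡Q′ = refl
countBelow-cong (suc m) Q≡Q′ =
  cong₂ _+_ (countBelow-cong m (λ i i<m → Q≡Q′ i (m≤n⇒m≤1+n i<m))) (cong bit (Q≡Q′ m ≤-refl))

countBelow-true : ∀ m → countBelow (λ _ → true) m ≡ m
countBelow-true zero    = refl
countBelow-true (suc m) = trans (+-comm _ 1) (cong suc (countBelow-true m))

_without_ : (ℕ → Bool) → ℕ → ℕ → Bool
(Q without a) i = Q i ∧ not (i ≡ᵇ a)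

without-≢ : ∀ Q {a i} → i ≢ a → (Q without a) i ≡ Q i
without-≢ Q {a} {i} i≢a rewrite dec-false (i ≟ a) i≢a = ∧-identityʳ (Q i)

without-self : ∀ Q a → (Q without a) a ≡ false
without-self Q a rewrite dec-true (a ≟ a) refl = ∧-zeroʳ (Q a)

countBelow-without : ∀ Q a m → Q a ≡ true → a < m → countBelow Q m ≡ suc (countBelow (Q without a) m)
countBelow-without Q a (suc m) Qa (s≤s a≤m) with m≤n⇒m<n∨m≡n a≤m
... | inj₁ a<m = cong₂ _+_ (countBelow-without Q a m Qa a<m)
                           (cong bit (sym (without-≢ Q (λ m≡a → <-irrefl (sym m≡a) a<m))))
... | inj₂ refl = begin
  countBelow Q a + bit (Q a)                    ≡⟨ cong₂ _+_ below-a (cong bit Qa) ⟩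
  countBelow (Q without a) a + 1                ≡⟨ +-comm _ 1 ⟩
  suc (countBelow (Q without a) a)              ≡⟨ cong suc (+-identityʳ _) ⟨
  suc (countBelow (Q without a) a + 0)          ≡⟨ cong (λ v → suc (countBelow (Q without a) a + bit v)) (without-self Q a) ⟨
  suc (countBelow (Q without a) a + bit ((Q without a) a)) ∎
  where
  open ≡-Reasoning
  below-a : countBelow Q a ≡ countBelow (Q without a) a
  below-a = countBelow-cong a (λ i i<a → sym (without-≢ Q (λ i≡a → <-irrefl i≡a i<a)))

Unique⇒length≤countBelow : ∀ Q m (A : List ℕ) → Unique A →
                           (∀ a → a ∈ A → a < m × Q a ≡ true) → length A ≤ countBelow Q m
Unique⇒length≤countBelow Q m []      _            _     = z≤n
Unique⇒length≤countBelow Q m (a ∷ A) (a∉A ∷ uniq) A⊆Q with A⊆Q a (here refl)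
... | a<m , Qa = subst (suc (length A) ≤_) (sym (countBelow-without Q a m Qa a<m))
                       (s≤s (Unique⇒length≤countBelow (Q without a) m A uniq A⊆Q′))
  where
  A⊆Q′ : ∀ b → b ∈ A → b < m × (Q without a) b ≡ true
  A⊆Q′ b b∈A = let (b<m , Qb) = A⊆Q b (there b∈A) in
    b<m , trans (without-≢ Q (λ b≡a → All.lookup a∉A b∈A (sym b≡a))) Qb

Unique⇒length≤ : ∀ (A : List ℕ) m → Unique A → (∀ a → a ∈ A → a < m) → length A ≤ m
Unique⇒length≤ A m uniq A<m =
  subst (length A ≤_) (countBelow-true m) (Unique⇒length≤countBelow _ m A uniq (λ a a∈A → A<m a a∈A , refl))

filterBelow : (ℕ → Bool) → ℕ → List ℕ
filterBelow Q zero    = []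
filterBelow Q (suc m) = if Q m then m ∷ filterBelow Q m else filterBelow Q m

∈-filterBelow⁻ : ∀ Q m {a} → a ∈ filterBelow Q m → a < m × Q a ≡ true
∈-filterBelow⁻ Q (suc m) a∈ with Q m in Qm
∈-filterBelow⁻ Q (suc m) (here refl) | true = ≤-refl , Qm
∈-filterBelow⁻ Q (suc m) (there a∈) | true =
  let (a<m , Qa) = ∈-filterBelow⁻ Q m a∈ in m≤n⇒m≤1+n a<m , Qa
... | false = let (a<m , Qa) = ∈-filterBelow⁻ Q m a∈ in m≤n⇒m≤1+n a<m , Qa

filterBelow-unique : ∀ Q m → Unique (filterBelow Q m)
filterBelow-unique Q zero    = []
filterBelow-unique Q (suc m) with Q m
... | true  = All.tabulate (λ a∈ m≡a → <-irrefl (sym m≡a) (proj₁ (∈-filterBelow⁻ Q m a∈)))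
              ∷ filterBelow-unique Q m
... | false = filterBelow-unique Q m

length-filterBelow : ∀ Q m → length (filterBelow Q m) ≡ countBelow Q m
length-filterBelow Q zero    = refl
length-filterBelow Q (suc m) with Q m
... | true  = trans (cong suc (length-filterBelow Q m)) (+-comm 1 (countBelow Q m))
... | false = trans (length-filterBelow Q m) (sym (+-identityʳ _))

∈⇒<suc-max : ∀ {a} (A : List ℕ) → a ∈ A → a < suc (max 0 A)
∈⇒<suc-max A a∈A = s≤s (All.lookup (xs≤max 0 A) a∈A)

memberOf : List ℕ → ℕ → Bool
memberOf A i = does (i ∈? A)

memberOf-true⇒∈ : ∀ A {i} → memberOf A i ≡ true → i ∈ A
memberOf-true⇒∈ A {i} _ with i ∈? A
... | yes i∈A = i∈A

memberOf-∈ : ∀ A {i} → i ∈ A → memberOf A i ≡ true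
memberOf-∈ A {i} i∈A = dec-true (i ∈? A) i∈A

Shatters-⊆ : ∀ 𝒞 A A′ → Shatters 𝒞 A → (∀ {a} → a ∈ A′ → a ∈ A) → Shatters 𝒞 A′
Shatters-⊆ 𝒞 A A′ shatters A′⊆A T =
  let (B , 𝒞B , B≡T) = shatters T in B , 𝒞B , λ a a∈A′ → B≡T a (A′⊆A a∈A′)

ShatteredOfSize-≤ : ∀ 𝒞 A k → Unique A → Shatters 𝒞 A → k ≤ length A → ShatteredOfSize 𝒞 k
ShatteredOfSize-≤ 𝒞 A k uniq shatters k≤|A| =
  take k A , take⁺ k uniq , Shatters-⊆ 𝒞 A (take k A) shatters (lookup (take-⊆ k A)) ,
  trans (length-take k A) (m≤n⇒m⊓n≡m k≤|A|)

listing : (ℕ → Bool) → Baire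
listing B n = if B n then suc n else 0

InRange-listing⁻ : ∀ B n → InRange (listing B) n → B n ≡ true
InRange-listing⁻ B n (k , listed) with B k in Bk
... | true = subst (λ m → B m ≡ true) (suc-injective listed) Bk

InRange-listing⁺ : ∀ B n → B n ≡ true → InRange (listing B) n
InRange-listing⁺ B n Bn = n , cong (λ b → if b then suc n else 0) Bn

InRange-≗ : ∀ {p q} → p ≗ q → ∀ n → InRange p n → InRange q n
InRange-≗ p≗q n (k , pk) = k , trans (sym (p≗q k)) pk

interleave : Baire → Baire → Baire
interleave f g m = if odd m then g ⌊ m /2⌋ else f ⌊ m /2⌋

evens-interleave : ∀ f g → evens (interleave f g) ≗ f
evens-interleave f g n rewrite sym (double≡2* n) =
  cong₂ (λ b k → if b then g k else f k) (odd-bit+double false n) (⌊bit+double/2⌋ false n)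

odds-interleave : ∀ f g → odds (interleave f g) ≗ g
odds-interleave f g n rewrite sym (double≡2* n) =
  cong₂ (λ b k → if b then g k else f k) (odd-bit+double true n) (⌊bit+double/2⌋ true n)

VCdim≤ᵖʳVCdim⁺ : VCdim ≤ᵖʳ VCdim⁺
VCdim≤ᵖʳVCdim⁺ = record
  { pre = evens
  ; post = λ q → q
  ; pre-computable = O[ P (# 0) +ᵖ P (# 0) ] , λ p n →
      cong p (trans (eval-+ᵖ p (n ∷ []) (P (# 0)) (P (# 0))) (cong (n +_) (sym (+-identityʳ n))))
  ; post-computable = PrimComputable-id
  ; translate = λ p A (positive , _) → A , positive , λ q y q-names-y vc → y , q-names-y , vc
  }

-- SORT reduces to VCdim

SubsetsOfZeros : Cantor → Pred
SubsetsOfZeros x B = ∀ i → B i ≡ true → x i ≡ false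

meetsZeros : Baire → ℕ → Bool
meetsZeros p n = allBelow (λ i → not (oneAt n i) ∨ (p i ≡ᵇ 0)) n

nameOfZeros : Baire → Baire
nameOfZeros p = interleave (listing (meetsZeros p)) (listing (not ∘ meetsZeros p))

module _ (p : Baire) (x : Cantor) (p-names-x : ∀ n → p n ≡ bit (x n)) where

  private
    p≡ᵇ0 : ∀ i → (p i ≡ᵇ 0) ≡ not (x i)
    p≡ᵇ0 i rewrite p-names-x i with x i
    ... | true  = refl
    ... | false = refl

  meetsZeros-elim : ∀ n → meetsZeros p n ≡ true → ∀ i → word n ‼ i ≡ just true → x i ≡ false
  meetsZeros-elim n meets i one with allBelow-elim _ n meets i (word-‼-< n i one)
  ... | allows rewrite one | p≡ᵇ0 i = not-injective allows

  meetsZeros-intro : ∀ n → (∀ i → word n ‼ i ≡ just true → x i ≡ false) → meetsZeros p n ≡ true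
  meetsZeros-intro n onesAtZeros = allBelow-intro _ n (λ i _ → allows i)
    where
    allows : ∀ i → not (oneAt n i) ∨ (p i ≡ᵇ 0) ≡ true
    allows i with word n ‼ i in one
    ... | just true  rewrite p≡ᵇ0 i | onesAtZeros i one = refl
    ... | just false = refl
    ... | nothing    = refl

  meetsZeros⇒meets : ∀ n → meetsZeros p n ≡ true → Σ Cantor λ B → InB n B × SubsetsOfZeros x B
  meetsZeros⇒meets n meets = zeroExtension (word n) , Prefix-zeroExtension (word n) ,
    λ i one → meetsZeros-elim n meets i (fromMaybe-true (word n ‼ i) one)

  meets⇒meetsZeros : ∀ n B → InB n B → SubsetsOfZeros x B → meetsZeros p n ≡ true
  meets⇒meetsZeros n B B∈Bₙ zeros = meetsZeros-intro n (λ i one → zeros i (Prefix-‼ (word n) B i B∈Bₙ one))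

  private
    Misses : Cantor → Set
    Misses B = Σ ℕ λ n → not (meetsZeros p n) ≡ true × InB n B

    misses⇒∉ : ∀ B → SubsetsOfZeros x B → ¬ Misses B
    misses⇒∉ B zeros (n , misses , B∈Bₙ) with meetsZeros p n | meets⇒meetsZeros n B B∈Bₙ zeros
    misses⇒∉ B zeros (n , () , B∈Bₙ) | true | refl

    -- a 1 of B at a 1 of x is seen by the prefix of B up to it
    ∉⇒misses : ∀ B → ¬ Misses B → SubsetsOfZeros x B
    ∉⇒misses B notMissed i Bi with x i in xi
    ... | false = refl
    ... | true  = ⊥-elim (notMissed (n , misses , InB-encode-prefixOf B (suc i)))
      where
      n : ℕ
      n = encode (prefixOf B (suc i))
      one : word n ‼ i ≡ just true
      one = trans (word-encode-prefixOf-‼ B (suc i) i ≤-refl) (cong just Bi)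
      misses : not (meetsZeros p n) ≡ true
      misses with meetsZeros p n in meets
      ... | false = refl
      ... | true  with () ← trans (sym xi) (meetsZeros-elim n meets i one)

  nameOfZeros-names : δ𝒜 (nameOfZeros p) (SubsetsOfZeros x)
  nameOfZeros-names = (closed , positive) , negative
    where
    listedPos listedNeg : Baire
    listedPos = listing (meetsZeros p)
    listedNeg = listing (not ∘ meetsZeros p)
    closed : Closed (SubsetsOfZeros x)
    closed = not ∘ meetsZeros p , λ B → misses⇒∉ B , ∉⇒misses B
    positive : ∀ n → (InRange (evens (nameOfZeros p)) n → Σ Cantor λ B → InB n B × SubsetsOfZeros x B) ×
                     ((Σ Cantor λ B → InB n B × SubsetsOfZeros x B) → InRange (evens (nameOfZeros p)) n)
    positive n =
      (λ listed → meetsZeros⇒meets n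
         (InRange-listing⁻ (meetsZeros p) n (InRange-≗ (evens-interleave listedPos listedNeg) n listed))) ,
      (λ (B , B∈Bₙ , zeros) → InRange-≗ (λ k → sym (evens-interleave listedPos listedNeg k)) n
                                 (InRange-listing⁺ _ n (meets⇒meetsZeros n B B∈Bₙ zeros)))
    negative : δ₋ (odds (nameOfZeros p)) (SubsetsOfZeros x)
    negative B =
      (λ zeros (n , listed , B∈Bₙ) → misses⇒∉ B zeros
         (n , InRange-listing⁻ _ n (InRange-≗ (odds-interleave listedPos listedNeg) n listed) , B∈Bₙ)) ,
      (λ notListed → ∉⇒misses B (λ (n , misses , B∈Bₙ) → notListed
         (n , InRange-≗ (λ k → sym (odds-interleave listedPos listedNeg k)) n (InRange-listing⁺ _ n misses) ,
          B∈Bₙ)))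

meetsZerosᵖ : Prim 1
meetsZerosᵖ = allBelowᵖ (P (# 0)) (notᵖ (oneAt[ P (# 1) , P (# 0) ]) ∨ᵖ (O[ P (# 0) ] ≡ᵖ lit 0))

listingᵖ : Prim 1 → Prim 1
listingᵖ b = ifZeroᵖ b (lit 0) (C S (P (# 0) ∷ []))

eval-listingᵖ : ∀ b B p n → eval b p (n ∷ []) ≡ bit (B n) → eval (listingᵖ b) p (n ∷ []) ≡ listing B n
eval-listingᵖ b B p n b≡B = begin
  eval (listingᵖ b) p (n ∷ [])       ≡⟨ eval-ifZeroᵖ b (lit 0) (C S (P (# 0) ∷ [])) p (n ∷ []) ⟩
  ifZero (eval b p (n ∷ [])) 0 (suc n) ≡⟨ cong (λ v → ifZero v 0 (suc n)) b≡B ⟩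
  ifZero (bit (B n)) 0 (suc n)        ≡⟨ ifZero-bit (B n) ⟩
  listing B n                          ∎
  where open ≡-Reasoning

nameOfZeros-computable : PrimComputable nameOfZeros
nameOfZeros-computable = nameᵖ , correct
  where
  posᵖ negᵖ nameᵖ : Prim 1
  posᵖ = C (listingᵖ meetsZerosᵖ) (halfᵖ (P (# 0)) ∷ [])
  negᵖ = C (listingᵖ (notᵖ meetsZerosᵖ)) (halfᵖ (P (# 0)) ∷ [])
  nameᵖ = ifZeroᵖ (oddᵖ (P (# 0))) posᵖ negᵖ

  eval-meetsZerosᵖ : ∀ p n → eval meetsZerosᵖ p (n ∷ []) ≡ bit (meetsZeros p n)
  eval-meetsZerosᵖ p n = eval-allBelowᵖ p (n ∷ []) (P (# 0)) (notᵖ oneᵖ ∨ᵖ (oracleᵖ ≡ᵖ lit 0)) _ λ i →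
    eval-∨ᵖ p (i ∷ n ∷ []) (notᵖ oneᵖ) (oracleᵖ ≡ᵖ lit 0)
      (eval-notᵖ p (i ∷ n ∷ []) oneᵖ (eval-oneAtᵖ p n i)) (eval-≡ᵖ p (i ∷ n ∷ []) oracleᵖ (lit 0))
    where
    oneᵖ oracleᵖ : Prim 2
    oneᵖ = oneAt[ P (# 1) , P (# 0) ]
    oracleᵖ = O[ P (# 0) ]

  eval-posᵖ : ∀ p m → ⟦ posᵖ ⟧ p m ≡ listing (meetsZeros p) ⌊ m /2⌋
  eval-posᵖ p m =
    trans (cong (λ k → eval (listingᵖ meetsZerosᵖ) p (k ∷ [])) (eval-halfᵖ p (m ∷ []) (P (# 0))))
          (eval-listingᵖ meetsZerosᵖ (meetsZeros p) p ⌊ m /2⌋ (eval-meetsZerosᵖ p ⌊ m /2⌋))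

  eval-negᵖ : ∀ p m → ⟦ negᵖ ⟧ p m ≡ listing (not ∘ meetsZeros p) ⌊ m /2⌋
  eval-negᵖ p m =
    trans (cong (λ k → eval (listingᵖ (notᵖ meetsZerosᵖ)) p (k ∷ [])) (eval-halfᵖ p (m ∷ []) (P (# 0))))
          (eval-listingᵖ (notᵖ meetsZerosᵖ) (not ∘ meetsZeros p) p ⌊ m /2⌋
            (eval-notᵖ p (⌊ m /2⌋ ∷ []) meetsZerosᵖ (eval-meetsZerosᵖ p ⌊ m /2⌋)))

  correct : ∀ p → ⟦ nameᵖ ⟧ p ≗ nameOfZeros p
  correct p m = begin
    ⟦ nameᵖ ⟧ p m
      ≡⟨ eval-ifZeroᵖ (oddᵖ (P (# 0))) posᵖ negᵖ p (m ∷ []) ⟩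
    ifZero (eval (oddᵖ (P (# 0))) p (m ∷ [])) (⟦ posᵖ ⟧ p m) (⟦ negᵖ ⟧ p m)
      ≡⟨ cong (λ v → ifZero v (⟦ posᵖ ⟧ p m) (⟦ negᵖ ⟧ p m)) (eval-oddᵖ p (m ∷ []) (P (# 0))) ⟩
    ifZero (bit (odd m)) (⟦ posᵖ ⟧ p m) (⟦ negᵖ ⟧ p m)
      ≡⟨ cong₂ (ifZero (bit (odd m))) (eval-posᵖ p m) (eval-negᵖ p m) ⟩
    ifZero (bit (odd m)) (listing (meetsZeros p) ⌊ m /2⌋) (listing (not ∘ meetsZeros p) ⌊ m /2⌋)
      ≡⟨ ifZero-bit (odd m) ⟩
    nameOfZeros p m
      ∎
    where open ≡-Reasoning

module _ (x : Cantor) where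

  Shatters-zeros⁻ : ∀ A → Shatters (SubsetsOfZeros x) A → ∀ a → a ∈ A → x a ≡ false
  Shatters-zeros⁻ A shatters a a∈A =
    let (B , zeros , B≡) = shatters (λ _ → true) in zeros a (B≡ a a∈A)

  Shatters-zeros⁺ : ∀ A → (∀ a → a ∈ A → x a ≡ false) → Shatters (SubsetsOfZeros x) A
  Shatters-zeros⁺ A zeros T = (λ i → T i ∧ memberOf A i) , inZeros , agrees
    where
    inZeros : SubsetsOfZeros x (λ i → T i ∧ memberOf A i)
    inZeros i Ti∧i∈A = zeros i (memberOf-true⇒∈ A (∧-conicalʳ _ _ Ti∧i∈A))
    agrees : ∀ a → a ∈ A → T a ∧ memberOf A a ≡ T a
    agrees a a∈A rewrite memberOf-∈ A a∈A = ∧-identityʳ (T a)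

  countZeros≡countBelow : ∀ N → countZeros x N ≡ countBelow (not ∘ x) N
  countZeros≡countBelow zero    = refl
  countZeros≡countBelow (suc N) = cong₂ _+_ (countZeros≡countBelow N) (zeroBit (x N))
    where
    zeroBit : ∀ b → (if b then 0 else 1) ≡ bit (not b)
    zeroBit false = refl
    zeroBit true  = refl

  VCdim-∞⇒InfZeros : VCdimIs (SubsetsOfZeros x) ∞ → InfZeros x
  VCdim-∞⇒InfZeros vc m with vc (suc m)
  ... | k , m<k , A , uniq , shatters , |A|≡k with any? (m ≤?_) A
  ...   | yes someBig = let (a , a∈A , m≤a) = find someBig in a , m≤a , Shatters-zeros⁻ A shatters a a∈A
  ...   | no  noneBig = ⊥-elim (1+n≰n (≤-trans m<k (subst (_≤ m) |A|≡k (Unique⇒length≤ A m uniq allSmall))))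
    where
    allSmall : ∀ a → a ∈ A → a < m
    allSmall a a∈A = ≰⇒> (All.lookup (¬Any⇒All¬ A noneBig) a∈A)

  private
    zeroSetOfSize : ∀ n → (n ≡ 0 ⊎ ShatteredOfSize (SubsetsOfZeros x) n) →
                    Σ (List ℕ) λ A → Unique A × (∀ a → a ∈ A → x a ≡ false) × length A ≡ n
    zeroSetOfSize n (inj₁ n≡0) = [] , [] , (λ a ()) , sym n≡0
    zeroSetOfSize n (inj₂ (A , uniq , shatters , |A|≡n)) = A , uniq , Shatters-zeros⁻ A shatters , |A|≡n

  -- every zero of x lies below N = 1 + max A for a largest shattered set A
  VCdim-fin⇒ExactlyZeros : ∀ n → VCdimIs (SubsetsOfZeros x) (fin n) → ExactlyZeros n x
  VCdim-fin⇒ExactlyZeros n (bounded , attained) with zeroSetOfSize n attained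
  ... | A , uniq , zeros , |A|≡n = N , zerosBelowN , beyond
    where
    N : ℕ
    N = suc (max 0 A)

    beyond : ∀ k → N ≤ k → x k ≡ true
    beyond k N≤k with x k in xk
    ... | true  = refl
    ... | false = ⊥-elim (1+n≰n (subst (λ l → suc l ≤ n) |A|≡n
                    (bounded (k ∷ A) (k∉A ∷ uniq) (Shatters-zeros⁺ (k ∷ A) zeros′))))
      where
      k∉A : All (k ≢_) A
      k∉A = All.tabulate (λ a∈A k≡a → <-irrefl (sym k≡a) (≤-trans (∈⇒<suc-max A a∈A) N≤k))
      zeros′ : ∀ a → a ∈ k ∷ A → x a ≡ false
      zeros′ a (here refl) = xk
      zeros′ a (there a∈A) = zeros a a∈A

    zerosBelowN : countZeros x N ≡ n
    zerosBelowN = trans (countZeros≡countBelow N) (≤-antisym upper lower)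
      where
      zs : List ℕ
      zs = filterBelow (not ∘ x) N
      upper : countBelow (not ∘ x) N ≤ n
      upper = subst (_≤ n) (length-filterBelow (not ∘ x) N)
        (bounded zs (filterBelow-unique (not ∘ x) N)
          (Shatters-zeros⁺ zs (λ a a∈zs → not-injective (proj₂ (∈-filterBelow⁻ (not ∘ x) N a∈zs)))))
      lower : n ≤ countBelow (not ∘ x) N
      lower = subst (_≤ countBelow (not ∘ x) N) |A|≡n
        (Unique⇒length≤countBelow (not ∘ x) N A uniq (λ a a∈A → ∈⇒<suc-max A a∈A , cong not (zeros a a∈A)))

sortOutput : ℕ∞ → Cantor
sortOutput (fin n) k = if k <ᵇ n then false else true
sortOutput ∞       k = false

VCdim⇒SORT : ∀ x y → VCdimIs (SubsetsOfZeros x) y → SORTrel x (sortOutput y)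
VCdim⇒SORT x (fin n) vc = inj₂ (n , VCdim-fin⇒ExactlyZeros x n vc , λ k → refl)
VCdim⇒SORT x ∞       vc = inj₁ (VCdim-∞⇒InfZeros x vc , λ k → refl)

seenNonZero : Baire → Cantor
seenNonZero q k = anyBelow (λ i → 0 <ᵇ q i) (suc k)

seenNonZero-sortOutput : ∀ q y → δℕ∞ q y → ∀ k → seenNonZero q k ≡ sortOutput y k
seenNonZero-sortOutput q ∞ zeros k = anyBelow-false _ (suc k) (λ i _ → cong (0 <ᵇ_) (zeros i))
seenNonZero-sortOutput q (fin n) (zeros , one) k with k <? n
... | yes k<n rewrite dec-true (k <? n) k<n =
  anyBelow-false _ (suc k) (λ i i<1+k → cong (0 <ᵇ_) (zeros i (≤-trans i<1+k k<n)))
... | no  k≮n rewrite dec-false (k <? n) k≮n =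
  anyBelow-intro _ (suc k) n (s≤s (≮⇒≥ k≮n)) (cong (0 <ᵇ_) one)

seenNonZero-computable : PrimComputable (λ q k → bit (seenNonZero q k))
seenNonZero-computable = anyBelowᵖ (C S (P (# 0) ∷ [])) (nonZeroᵖ O[ P (# 0) ]) , λ q k →
  eval-anyBelowᵖ q (k ∷ []) (C S (P (# 0) ∷ [])) (nonZeroᵖ O[ P (# 0) ]) _
    (λ i → eval-nonZeroᵖ q (i ∷ k ∷ []) O[ P (# 0) ])

SORT≤ᵖʳVCdim : SORT ≤ᵖʳ VCdim
SORT≤ᵖʳVCdim = record
  { pre = nameOfZeros
  ; post = λ q k → bit (seenNonZero q k)
  ; pre-computable = nameOfZeros-computable
  ; post-computable = seenNonZero-computable
  ; translate = λ p x p-names-x → SubsetsOfZeros x , nameOfZeros-names p x p-names-x ,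
      λ q y q-names-y vc → sortOutput y , (λ k → cong bit (seenNonZero-sortOutput q y q-names-y k)) ,
                           VCdim⇒SORT x y vc
  }

-- VCdim⁺ reduces to SORT

-- A code c stands for the candidate set {i < c : oneAt c i} and a code e < 2 ^ (c + 1) for
-- the pattern w_e on it; B_d realises the pattern if w_d fixes each candidate position to
-- the letter of w_e there.  Stage s accepts c if its candidate set has more than cnt
-- elements and each pattern is realised by a basic set listed among the first s entries
-- of the 𝒜₊-name p.
popcount : ℕ → ℕ
popcount c = countBelow (oneAt c) c

agrees : ℕ → ℕ → ℕ → ℕ → Bool
agrees c e d i = not (oneAt c i) ∨ (definedAt d i ∧ (bit (oneAt d i) ≡ᵇ bit (oneAt e i)))

witness : Baire → ℕ → ℕ → ℕ → Bool
witness p c e j = (0 <ᵇ p j) ∧ allBelow (agrees c e (pred (p j))) c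

witnessed : Baire → ℕ → ℕ → ℕ → Bool
witnessed p s c e = anyBelow (witness p c e) s

candidate : Baire → ℕ → ℕ → ℕ → Bool
candidate p s cnt c = (cnt <ᵇ popcount c) ∧ allBelow (witnessed p s c) (2 ^ suc c)

found : Baire → ℕ → ℕ → Bool
found p s cnt = anyBelow (candidate p s cnt) s

successes : Baire → ℕ → ℕ
successes p zero    = 0
successes p (suc s) = successes p s + bit (found p s (successes p s))

failures : Baire → Cantor
failures p s = not (found p s (successes p s))

agreesᵖ : Prim 4
agreesᵖ = notᵖ oneAt[ P (# 3) , P (# 0) ] ∨ᵖ
          (definedAt[ d , P (# 0) ] ∧ᵖ (oneAt[ d , P (# 0) ] ≡ᵖ oneAt[ P (# 2) , P (# 0) ]))
  where
  d : Prim 4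
  d = predᵖ O[ P (# 1) ]

popcountᵖ : Prim 1
popcountᵖ = sumBelowᵖ (P (# 0)) oneAt[ P (# 1) , P (# 0) ]

witnessᵖ witnessedᵖ candidateᵖ : Prim 3
witnessᵖ   = nonZeroᵖ O[ P (# 0) ] ∧ᵖ allBelowᵖ (P (# 2)) agreesᵖ
witnessedᵖ = anyBelowᵖ (P (# 2)) (C witnessᵖ (P (# 0) ∷ P (# 1) ∷ P (# 2) ∷ []))
candidateᵖ = (P (# 2) <ᵖ C popcountᵖ (P (# 0) ∷ [])) ∧ᵖ
             allBelowᵖ (2^ᵖ (C S (P (# 0) ∷ []))) (C witnessedᵖ (P (# 0) ∷ P (# 1) ∷ P (# 2) ∷ []))

foundᵖ : Prim 2
foundᵖ = anyBelowᵖ (P (# 0)) candidateᵖ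

successesᵖ failuresᵖ : Prim 1
successesᵖ = R Z (P (# 1) +ᵖ C foundᵖ (P (# 0) ∷ P (# 1) ∷ []))
failuresᵖ = notᵖ (C foundᵖ (P (# 0) ∷ C successesᵖ (P (# 0) ∷ []) ∷ []))

module _ (p : Baire) where

  eval-agreesᵖ : ∀ i j e c → eval agreesᵖ p (i ∷ j ∷ e ∷ c ∷ []) ≡ bit (agrees c e (pred (p j)) i)
  eval-agreesᵖ i j e c =
    eval-∨ᵖ p xs (notᵖ oneAt[ P (# 3) , P (# 0) ]) _
      (eval-notᵖ p xs oneAt[ P (# 3) , P (# 0) ] (eval-oneAtᵖ p c i))
      (eval-∧ᵖ p xs definedAt[ d , P (# 0) ] _
        (trans (cong (λ v → eval definedAtᵖ p (v ∷ i ∷ [])) d≡) (eval-definedAtᵖ p (pred (p j)) i))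
        (trans (eval-≡ᵖ p xs oneAt[ d , P (# 0) ] oneAt[ P (# 2) , P (# 0) ])
          (cong₂ (λ a b → bit (a ≡ᵇ b))
            (trans (cong (λ v → eval oneAtᵖ p (v ∷ i ∷ [])) d≡) (eval-oneAtᵖ p (pred (p j)) i))
            (eval-oneAtᵖ p e i))))
    where
    xs : Vec ℕ 4
    xs = i ∷ j ∷ e ∷ c ∷ []
    d : Prim 4
    d = predᵖ O[ P (# 1) ]
    d≡ : eval d p xs ≡ pred (p j)
    d≡ = eval-predᵖ p xs O[ P (# 1) ]

  eval-witnessᵖ : ∀ j e c → eval witnessᵖ p (j ∷ e ∷ c ∷ []) ≡ bit (witness p c e j)
  eval-witnessᵖ j e c = eval-∧ᵖ p (j ∷ e ∷ c ∷ []) (nonZeroᵖ O[ P (# 0) ]) _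
    (eval-nonZeroᵖ p (j ∷ e ∷ c ∷ []) O[ P (# 0) ])
    (eval-allBelowᵖ p (j ∷ e ∷ c ∷ []) (P (# 2)) agreesᵖ _ (λ i → eval-agreesᵖ i j e c))

  eval-witnessedᵖ : ∀ e c s → eval witnessedᵖ p (e ∷ c ∷ s ∷ []) ≡ bit (witnessed p s c e)
  eval-witnessedᵖ e c s = eval-anyBelowᵖ p (e ∷ c ∷ s ∷ []) (P (# 2)) _ _ (λ j → eval-witnessᵖ j e c)

  eval-candidateᵖ : ∀ c s cnt → eval candidateᵖ p (c ∷ s ∷ cnt ∷ []) ≡ bit (candidate p s cnt c)
  eval-candidateᵖ c s cnt = eval-∧ᵖ p xs (P (# 2) <ᵖ C popcountᵖ (P (# 0) ∷ [])) _
    (trans (eval-<ᵖ p xs (P (# 2)) (C popcountᵖ (P (# 0) ∷ [])))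
      (cong (λ v → bit (cnt <ᵇ v)) (eval-sumBelowᵖ p (c ∷ []) (P (# 0)) _ _ (λ i → eval-oneAtᵖ p c i))))
    (trans (eval-allBelowᵖ p xs (2^ᵖ (C S (P (# 0) ∷ []))) _ _ (λ e → eval-witnessedᵖ e c s))
      (cong (λ v → bit (allBelow (witnessed p s c) v)) (eval-2^ᵖ p xs (C S (P (# 0) ∷ [])))))
    where
    xs : Vec ℕ 3
    xs = c ∷ s ∷ cnt ∷ []

  eval-foundᵖ : ∀ s cnt → eval foundᵖ p (s ∷ cnt ∷ []) ≡ bit (found p s cnt)
  eval-foundᵖ s cnt = eval-anyBelowᵖ p (s ∷ cnt ∷ []) (P (# 0)) candidateᵖ _ (λ c → eval-candidateᵖ c s cnt)

  eval-successesᵖ : ∀ s → ⟦ successesᵖ ⟧ p s ≡ successes p s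
  eval-successesᵖ zero    = refl
  eval-successesᵖ (suc s) = begin
    ⟦ successesᵖ ⟧ p (suc s)
      ≡⟨ eval-+ᵖ p (s ∷ c ∷ []) (P (# 1)) (C foundᵖ (P (# 0) ∷ P (# 1) ∷ [])) ⟩
    c + eval foundᵖ p (s ∷ c ∷ [])
      ≡⟨ cong (λ v → v + eval foundᵖ p (s ∷ v ∷ [])) (eval-successesᵖ s) ⟩
    successes p s + eval foundᵖ p (s ∷ successes p s ∷ [])
      ≡⟨ cong (successes p s +_) (eval-foundᵖ s (successes p s)) ⟩
    successes p (suc s)
      ∎
    where
    open ≡-Reasoning
    c : ℕ
    c = ⟦ successesᵖ ⟧ p s

failures-computable : PrimComputable (λ p s → bit (failures p s))
failures-computable = failuresᵖ , λ p s →
  eval-notᵖ p (s ∷ []) (C foundᵖ (P (# 0) ∷ C successesᵖ (P (# 0) ∷ []) ∷ []))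
    (trans (cong (λ v → eval foundᵖ p (s ∷ v ∷ [])) (eval-successesᵖ p s)) (eval-foundᵖ p s (successes p s)))

agrees-elim : ∀ c e d i → agrees c e d i ≡ true → oneAt c i ≡ true → word d ‼ i ≡ just (oneAt e i)
agrees-elim c e d i agree one rewrite one with word d ‼ i
... | just b = cong just (bit-≡ᵇ b (oneAt e i) agree)

agrees-intro : ∀ c e d i → (oneAt c i ≡ true → word d ‼ i ≡ just (oneAt e i)) → agrees c e d i ≡ true
agrees-intro c e d i letter with oneAt c i
... | false = refl
... | true rewrite letter refl = bit-≡ᵇ-refl (oneAt e i)

candidateSet : ℕ → List ℕ
candidateSet c = filterBelow (oneAt c) c

patternCode : Cantor → ℕ → ℕ
patternCode T c = encode (prefixOf T c)

patternCode< : ∀ T c → patternCode T c < 2 ^ suc c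
patternCode< T c = subst (λ l → patternCode T c < 2 ^ suc l) (length-prefixOf T c) (encode< (prefixOf T c))

oneAt-patternCode : ∀ T c a → a < c → oneAt (patternCode T c) a ≡ T a
oneAt-patternCode T c a a<c =
  trans (cong (fromMaybe false) (word-encode-prefixOf-‼ T c a a<c)) (fromMaybe-just (T a))

characteristicCode : List ℕ → ℕ
characteristicCode L = encode (prefixOf (memberOf L) (suc (max 0 L)))

module _ (L : List ℕ) where

  private
    N : ℕ
    N = suc (max 0 L)

  oneAt-characteristicCode : ∀ i → oneAt (characteristicCode L) i ≡ memberOf L i
  oneAt-characteristicCode i with i <? N
  ... | yes i<N = trans (cong (fromMaybe false) (word-encode-prefixOf-‼ (memberOf L) N i i<N)) (fromMaybe-just _)
  ... | no  i≮N = begin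
    fromMaybe false (word (characteristicCode L) ‼ i)  ≡⟨ cong (λ w → fromMaybe false (w ‼ i)) (word-encode w) ⟩
    fromMaybe false (w ‼ i)                            ≡⟨ cong (fromMaybe false) (‼-beyond w i |w|≤i) ⟩
    false                                              ≡⟨ dec-false (i ∈? L) (λ i∈L → i≮N (∈⇒<suc-max L i∈L)) ⟨
    memberOf L i                                       ∎
    where
    open ≡-Reasoning
    w : List Bool
    w = prefixOf (memberOf L) N
    |w|≤i : length w ≤ i
    |w|≤i = subst (_≤ i) (sym (length-prefixOf (memberOf L) N)) (≮⇒≥ i≮N)

  ∈⇒<characteristicCode : ∀ {a} → a ∈ L → a < characteristicCode L
  ∈⇒<characteristicCode a∈L = ≤-trans (∈⇒<suc-max L a∈L)
    (subst (_≤ characteristicCode L) (length-prefixOf (memberOf L) N) (length≤encode (prefixOf (memberOf L) N)))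

successes-mono : ∀ p {s t} → s ≤ t → successes p s ≤ successes p t
successes-mono p {t = zero}  z≤n = ≤-refl
successes-mono p {t = suc t} s≤1+t with m≤n⇒m<n∨m≡n s≤1+t
... | inj₁ (s≤s s≤t) = ≤-trans (successes-mono p s≤t) (m≤m+n _ _)
... | inj₂ refl      = ≤-refl

successes-success : ∀ p k → failures p k ≡ false → successes p (suc k) ≡ suc (successes p k)
successes-success p k success =
  trans (cong (λ b → successes p k + bit b) (not-injective success)) (+-comm (successes p k) 1)

countZeros-failures : ∀ p N → countZeros (failures p) N ≡ successes p N
countZeros-failures p zero    = refl
countZeros-failures p (suc N) = cong₂ _+_ (countZeros-failures p N) (zeroBit (found p N (successes p N)))
  where
  zeroBit : ∀ b → (if not b then 0 else 1) ≡ bit b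
  zeroBit false = refl
  zeroBit true  = refl

successes-passes : ∀ p m N → suc m ≤ successes p N → Σ ℕ λ s → successes p s ≡ m × found p s m ≡ true
successes-passes p m (suc N) m<successes with suc m ≤? successes p N | found p N (successes p N) in f
... | yes m<successesₙ | _     = successes-passes p m N m<successesₙ
... | no  m≮successesₙ | false = ⊥-elim (m≮successesₙ (subst (suc m ≤_) (+-identityʳ _) m<successes))
... | no  m≮successesₙ | true  = N , successesₙ≡m , subst (λ k → found p N k ≡ true) successesₙ≡m f
  where
  successesₙ≡m : successes p N ≡ m
  successesₙ≡m = ≤-antisym (≤-pred (≰⇒> m≮successesₙ))
                           (≤-pred (subst (suc m ≤_) (+-comm (successes p N) 1) m<successes))

module _ (p : Baire) (A : Pred) (p-names-A : δ₊ p A) where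

  private
    listed⇒meets : ∀ d → InRange p d → Σ Cantor λ B → InB d B × A B
    listed⇒meets d = proj₁ (proj₂ p-names-A d)

    meets⇒listed : ∀ d B → InB d B → A B → InRange p d
    meets⇒listed d B B∈B_d AB = proj₂ (proj₂ p-names-A d) (B , B∈B_d , AB)

  witness⇒realised : ∀ c e j → witness p c e j ≡ true →
                     Σ Cantor λ B → A B × (∀ a → a < c → oneAt c a ≡ true → B a ≡ oneAt e a)
  witness⇒realised c e j w with p j in pj
  ... | suc d = let (B , B∈B_d , AB) = listed⇒meets d (j , pj) in
    B , AB , λ a a<c one → Prefix-‼ (word d) B a B∈B_d (agrees-elim c e d a (allBelow-elim _ c w a a<c) one)

  candidate⇒shattered : ∀ s cnt c → candidate p s cnt c ≡ true →
                        Unique (candidateSet c) × Shatters A (candidateSet c) × cnt < length (candidateSet c)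
  candidate⇒shattered s cnt c cand = filterBelow-unique (oneAt c) c , shatters ,
    subst (cnt <_) (sym (length-filterBelow (oneAt c) c)) (<ᵇ-true⇒< (∧-conicalˡ _ _ cand))
    where
    shatters : Shatters A (candidateSet c)
    shatters T
      with anyBelow-elim _ s (allBelow-elim _ _ (∧-conicalʳ _ _ cand) (patternCode T c) (patternCode< T c))
    ... | j , _ , w with witness⇒realised c (patternCode T c) j w
    ...   | B , AB , B≡pattern = B , AB , λ a a∈ →
      let (a<c , one) = ∈-filterBelow⁻ (oneAt c) c a∈ in
      trans (B≡pattern a a<c one) (oneAt-patternCode T c a a<c)

  found⇒shattered : ∀ s cnt → found p s cnt ≡ true →
                    Σ (List ℕ) λ L → Unique L × Shatters A L × cnt < length L
  found⇒shattered s cnt f with anyBelow-elim _ s f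
  ... | c , _ , cand = candidateSet c , candidate⇒shattered s cnt c cand

  witness-intro : ∀ c e j d → p j ≡ suc d → (∀ i → i < c → agrees c e d i ≡ true) → witness p c e j ≡ true
  witness-intro c e j d pj agree rewrite pj = allBelow-intro _ c agree

  realised⇒witness : ∀ L → Shatters A L → ∀ e → Σ ℕ λ j → witness p (characteristicCode L) e j ≡ true
  realised⇒witness L shatters e =
    let (B , AB , B≡pattern) = shatters (oneAt e)
        (j , pj) = meets⇒listed (d B) B (InB-encode-prefixOf B N) AB
    in j , witness-intro c e j (d B) pj (λ i _ → agrees-intro c e (d B) i (letter B B≡pattern i))
    where
    N c : ℕ
    N = suc (max 0 L)
    c = characteristicCode L
    d : Cantor → ℕ
    d B = encode (prefixOf B N)
    letter : ∀ B → (∀ a → a ∈ L → B a ≡ oneAt e a) → ∀ i → oneAt c i ≡ true → word (d B) ‼ i ≡ just (oneAt e i)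
    letter B B≡pattern i one =
      let i∈L = memberOf-true⇒∈ L (trans (sym (oneAt-characteristicCode L i)) one) in
      trans (word-encode-prefixOf-‼ B N i (∈⇒<suc-max L i∈L)) (cong just (B≡pattern i i∈L))

  shattered⇒found : ∀ L cnt → Unique L → Shatters A L → cnt < length L →
                    Σ ℕ λ s₀ → ∀ s → s₀ ≤ s → found p s cnt ≡ true
  shattered⇒found L cnt uniq shatters cnt<|L| = suc c ⊔ M , eventually
    where
    c : ℕ
    c = characteristicCode L
    witnessesBelow : Σ ℕ λ M → ∀ e → e < 2 ^ suc c → Σ ℕ λ j → j < M × witness p c e j ≡ true
    witnessesBelow = uniformBound (witness p c) (2 ^ suc c) (λ e _ → realised⇒witness L shatters e)
    M : ℕ
    M = proj₁ witnessesBelow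
    big : (cnt <ᵇ popcount c) ≡ true
    big = <⇒<ᵇ-true (≤-trans cnt<|L| (Unique⇒length≤countBelow (oneAt c) c L uniq (λ a a∈L →
            ∈⇒<characteristicCode L a∈L , trans (oneAt-characteristicCode L a) (memberOf-∈ L a∈L))))
    eventually : ∀ s → suc c ⊔ M ≤ s → found p s cnt ≡ true
    eventually s s₀≤s = anyBelow-intro _ s c (≤-trans (m≤m⊔n (suc c) M) s₀≤s) isCandidate
      where
      isCandidate : candidate p s cnt c ≡ true
      isCandidate rewrite big = allBelow-intro _ (2 ^ suc c) λ e e< →
        let (j , j<M , w) = proj₂ witnessesBelow e e< in
        anyBelow-intro _ s j (≤-trans j<M (≤-trans (m≤n⊔m (suc c) M) s₀≤s)) w

  failures-∞ : InfZeros (failures p) → VCdimIs A ∞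
  failures-∞ infinite m =
    let (s , m≤successesₛ) = reach m
        (k , s≤k , zeroₖ) = infinite s
        (L , uniq , shatters , successesₖ<|L|) = found⇒shattered k (successes p k) (not-injective zeroₖ)
    in length L , ≤-trans m≤successesₛ (≤-trans (successes-mono p s≤k) (≤-trans (n≤1+n _) successesₖ<|L|)) ,
       L , uniq , shatters , refl
    where
    reach : ∀ m → Σ ℕ λ s → m ≤ successes p s
    reach zero    = 0 , z≤n
    reach (suc m) =
      let (s , m≤successesₛ) = reach m
          (k , s≤k , zeroₖ) = infinite s
      in suc k , subst (suc m ≤_) (sym (successes-success p k zeroₖ))
                       (s≤s (≤-trans m≤successesₛ (successes-mono p s≤k)))

  failures-fin : ∀ n → ExactlyZeros n (failures p) → VCdimIs A (fin n)
  failures-fin n (N , zerosₙ , beyond) = bounded , attained n successesₙ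
    where
    successesₙ : successes p N ≡ n
    successesₙ = trans (sym (countZeros-failures p N)) zerosₙ
    stable : ∀ s → N ≤ s → successes p s ≡ n
    stable s N≤s with m≤n⇒m<n∨m≡n N≤s
    ... | inj₂ refl = successesₙ
    stable (suc s) _ | inj₁ (s≤s N≤s) =
      trans (cong (λ b → successes p s + bit b) (not-injective (beyond s N≤s)))
            (trans (+-identityʳ _) (stable s N≤s))
    neverFoundAfter : ∀ s → N ≤ s → found p s n ≡ false
    neverFoundAfter s N≤s = trans (cong (found p s) (sym (stable s N≤s))) (not-injective (beyond s N≤s))
    bounded : ∀ L → Unique L → Shatters A L → length L ≤ n
    bounded L uniq shatters with length L ≤? n
    ... | yes |L|≤n = |L|≤n
    ... | no  |L|≰n with shattered⇒found L n uniq shatters (≰⇒> |L|≰n)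
    ...   | s₀ , eventually
      with () ← trans (sym (neverFoundAfter (s₀ ⊔ N) (m≤n⊔m s₀ N))) (eventually (s₀ ⊔ N) (m≤m⊔n s₀ N))
    attained : ∀ n′ → successes p N ≡ n′ → n′ ≡ 0 ⊎ ShatteredOfSize A n′
    attained zero    _      = inj₁ refl
    attained (suc m) successes≡ =
      let (s , successesₛ≡m , f) = successes-passes p m N (≤-reflexive (sym successes≡))
          (L , uniq , shatters , m<|L|) = found⇒shattered s m f
      in inj₂ (ShatteredOfSize-≤ A L (suc m) uniq shatters m<|L|)

  sorted⇒VCdim : ∀ q y → (∀ k → q k ≡ bit (y k)) → SORTrel (failures p) y →
                 Σ ℕ∞ λ d → δℕ∞ q d × VCdimIs A d
  sorted⇒VCdim q y q-names-y (inj₁ (infinite , y≡0)) =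
    ∞ , (λ i → trans (q-names-y i) (cong bit (y≡0 i))) , failures-∞ infinite
  sorted⇒VCdim q y q-names-y (inj₂ (n , exactly , y≡sorted)) = fin n , (zeros , one) , failures-fin n exactly
    where
    sortedBit : ∀ k → q k ≡ bit (if k <ᵇ n then false else true)
    sortedBit k = trans (q-names-y k) (cong bit (y≡sorted k))
    zeros : ∀ i → i < n → q i ≡ 0
    zeros i i<n = trans (sortedBit i) (cong (λ b → bit (if b then false else true)) (<⇒<ᵇ-true i<n))
    one : q n ≡ 1
    one = trans (sortedBit n)
                (cong (λ b → bit (if b then false else true)) (dec-false (n <? n) (<-irrefl refl)))

VCdim⁺≤ᵖʳSORT : VCdim⁺ ≤ᵖʳ SORT
VCdim⁺≤ᵖʳSORT = record
  { pre = λ p s → bit (failures p s)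
  ; post = λ q → q
  ; pre-computable = failures-computable
  ; post-computable = PrimComputable-id
  ; translate = λ p A p-names-A → failures p , (λ s → refl) , sorted⇒VCdim p A p-names-A
  }

theorem27 : (VCdim ≡sW VCdim⁺) × (VCdim⁺ ≡sW SORT)
theorem27 =
  (≤ᵖʳ⇒≤sW VCdim≤ᵖʳVCdim⁺ , ≤ᵖʳ⇒≤sW (≤ᵖʳ-trans VCdim⁺≤ᵖʳSORT SORT≤ᵖʳVCdim)) ,
  (≤ᵖʳ⇒≤sW VCdim⁺≤ᵖʳSORT , ≤ᵖʳ⇒≤sW (≤ᵖʳ-trans SORT≤ᵖʳVCdim VCdim≤ᵖʳVCdim⁺))
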